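{- For $n\geq1$, $q_{n+1}=2n(q_n+q_{n-1})$, with $q_0=1$, $q_1=0$, $q_2=2$.
   Context: Let $[n]_2=\{1,1,\ldots,n,n\}$. A Stirling permutation of order $k$ is a permutation of $[k]_2$ such that for each $i$ every entry between the two occurrences of $i$ is greater than $i$; $\mathcal{Q}_k$ denotes their set. For a word $\omega$, ${\rm red}(\omega)$ replaces each occurrence of the $i$th smallest distinct value by $i$. A Stirling permutation of the second kind of order $n$ is a permutation $\sigma$ of $[n]_2$ written as a nonempty disjoint union of cycles in standard cycle form such that: (i) the two copies of each $i\in[n]$ lie in the same cycle; (ii) each cycle is written with one of its smallest entries first and cycles are in increasing order of smallest entries; (iii) for each cycle $(c_1,\ldots,c_{2k})$, ${\rm red}(c_1\cdots c_{2k})\in\mathcal{Q}_k$. $\mathcal{Q}_n^2$ is the set of these. A Stirling derangement is $\sigma\in\mathcal{Q}_n^2$ having no cycle of the form $(kk)$; $\mathcal{DQ}_n$ is the set of them, $q_n=\#\mathcal{DQ}_n$ for $n\ge1$ and $q_0=1$. -}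

module Defs where

open import Data.Bool using (Bool; true; false; _∧_; _∨_; not; if_then_else_)
open import Data.Nat using (ℕ; zero; suc; _+_; _*_; _≡ᵇ_; _<ᵇ_; _≤ᵇ_)
open import Data.Nat.DivMod using (_/_)
open import Data.List using (List; []; _∷_; map; concat; concatMap; length; upTo; filterᵇ; takeWhileᵇ; deduplicateᵇ)
open import Data.Bool.ListAction using (all; any)

range1 : ℕ → List ℕ
range1 n = map suc (upTo n)

count : ℕ → List ℕ → ℕ
count x w = length (filterᵇ (x ≡ᵇ_) w)

_∈ᵇ_ : ℕ → List ℕ → Bool
x ∈ᵇ w = any (x ≡ᵇ_) w

isPermOf[_]₂ : ℕ → List ℕ → Bool
isPermOf[ n ]₂ w =
  (length w ≡ᵇ (2 * n)) ∧ all (λ x → (1 ≤ᵇ x) ∧ (x ≤ᵇ n)) w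
  ∧ all (λ i → count i w ≡ᵇ 2) (range1 n)

betweenGreater : List ℕ → Bool
betweenGreater []       = true
betweenGreater (x ∷ xs) =
  (if x ∈ᵇ xs then all (x <ᵇ_) (takeWhileᵇ (λ y → not (y ≡ᵇ x)) xs) else true)
  ∧ betweenGreater xs

isStirling : ℕ → List ℕ → Bool
isStirling k w = isPermOf[ k ]₂ w ∧ betweenGreater w

distinct : List ℕ → List ℕ
distinct = deduplicateᵇ _≡ᵇ_

red : List ℕ → List ℕ
red w = map (λ x → suc (length (filterᵇ (_<ᵇ x) (distinct w)))) w

cycleOK : List ℕ → Bool
cycleOK []       = false
cycleOK (c ∷ cs) = all (c ≤ᵇ_) (c ∷ cs) ∧ isStirling (length (c ∷ cs) / 2) (red (c ∷ cs))

copiesTogether : List (List ℕ) → Bool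
copiesTogether cs = all (λ c → all (λ x → count x c ≡ᵇ 2) c) cs

-- first entry of a cycle (0 for the empty list; never used on valid cycles)
first : List ℕ → ℕ
first []      = 0
first (x ∷ _) = x

increasingFirsts : List (List ℕ) → Bool
increasingFirsts []             = true
increasingFirsts (c ∷ [])       = true
increasingFirsts (c ∷ d ∷ rest) = (first c <ᵇ first d) ∧ increasingFirsts (d ∷ rest)

nonempty : {A : Set} → List A → Bool
nonempty []      = false
nonempty (_ ∷ _) = true

-- σ ∈ 𝒬²_n : a Stirling permutation of the second kind of order n,
-- given as its list of cycles in standard cycle form
isStirling2 : ℕ → List (List ℕ) → Bool
isStirling2 n cs =
  nonempty cs ∧ isPermOf[ n ]₂ (concat cs) ∧ copiesTogether cs
  ∧ all cycleOK cs ∧ increasingFirsts cs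

isFixedCycle : List ℕ → Bool
isFixedCycle (x ∷ y ∷ []) = x ≡ᵇ y
isFixedCycle _            = false

isStirlingDerangement : ℕ → List (List ℕ) → Bool
isStirlingDerangement n cs = isStirling2 n cs ∧ not (any isFixedCycle cs)

words : ℕ → ℕ → List (List ℕ)
words zero    m = [] ∷ []
words (suc l) m = concatMap (λ x → map (x ∷_) (words l m)) (range1 m)

segmentations : List ℕ → List (List (List ℕ))
segmentations []       = [] ∷ []
segmentations (x ∷ xs) = concatMap step (segmentations xs)
  where
  step : List (List ℕ) → List (List (List ℕ))
  step []       = ((x ∷ []) ∷ []) ∷ []
  step (b ∷ bs) = ((x ∷ []) ∷ b ∷ bs) ∷ ((x ∷ b) ∷ bs) ∷ []

-- every σ ∈ 𝒬²_n occurs exactly once here (as a cut of its word c₁⋯ of length 2n)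
candidates : ℕ → List (List (List ℕ))
candidates n = concatMap segmentations (words (2 * n) n)

q : ℕ → ℕ
q zero    = 1
q (suc n) = length (filterᵇ (isStirlingDerangement (suc n)) (candidates (suc n)))

-- Let Q² n j be the number of σ ∈ 𝒬²_n with exactly j cycles (k k), so that q_n = Q² n 0. In
-- σ ∈ 𝒬²_{n+1} the two copies of n+1 are adjacent, since nothing larger fits between them. Deleting
-- them leaves σ′ ∈ 𝒬²_n, and σ is recovered from σ′ either by inserting the pair after one of the 2n
-- entries of σ′ (which destroys the cycle (k k) it lands in, if any) or by appending the cycle
-- ((n+1) (n+1)). Counting fixed cycles through this bijection gives
--   Q² (n+1) j + 2j Q² n j = 2(j+1) Q² n (j+1) + 2n Q² n j + Q² n (j-1),
-- which determines Q² (n+1) from Q² n. The closed form C(n,j) q_{n-j}, with q defined by the recurrence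
-- of the theorem, satisfies the same relation and agrees at n = 1, so Q² n 0 = q_n.

module Submission where

open import Data.Bool using (Bool; true; false; _∧_; _∨_; not; if_then_else_)
open import Data.Bool.Properties using (T-≡; ∨-identityʳ; ∧-identityʳ; ∧-assoc)
open import Data.Bool.ListAction using (all; any)
open import Data.Nat using (ℕ; zero; suc; _+_; _*_; _∸_; _≡ᵇ_; _<ᵇ_; _≤ᵇ_; _≤_; _<_; z≤n; s≤s; _/_)
open import Data.Nat.Properties
open import Data.Nat.DivMod using (m*n/n≡m)
open import Data.Nat.ListAction using (sum)
open import Data.Nat.Combinatorics using (_C_; nC1≡n; k>n⇒nCk≡0; nCk+nC[k+1]≡[n+1]C[k+1])
open import Data.Nat.Tactic.RingSolver using (solve-∀)
open import Data.List using (List; []; _∷_; _++_; map; concat; concatMap; length; null; filter; filterᵇ; takeWhileᵇ; upTo; take; drop)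
open import Data.List.Properties using (length-map; map-++; upTo-∷ʳ; concatMap-cong; length-++; concat-++; take++drop≡id; length-take)
open import Data.List.Relation.Unary.All as All using (All; []; _∷_)
open import Data.List.Relation.Unary.All.Properties using (++⁺; ++⁻; map⁺; filter⁺; concat⁺; concat⁻; take⁺; drop⁺)
open import Data.Product using (_×_; _,_; proj₁; proj₂)
open import Data.Sum using (_⊎_; inj₁; inj₂)
open import Function using (_∘_; Equivalence)
open import Relation.Nullary using (¬_; contradiction)
open import Relation.Nullary.Decidable using (¬?; T?)
open import Relation.Binary.Definitions using (tri<; tri≈; tri>)
open import Relation.Binary.PropositionalEquality
open ≡-Reasoning

open import Defs

𝟙 : Bool → ℕ
𝟙 true  = 1
𝟙 false = 0

𝟙-∧ : ∀ a b → 𝟙 (a ∧ b) ≡ 𝟙 a * 𝟙 b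
𝟙-∧ true  b = sym (+-identityʳ (𝟙 b))
𝟙-∧ false b = refl

∧-true⇒ : ∀ {a b} → (a ∧ b) ≡ true → a ≡ true × b ≡ true
∧-true⇒ {true} {true} _ = refl , refl

∨-true⇒ : ∀ {a b} → (a ∨ b) ≡ true → a ≡ true ⊎ b ≡ true
∨-true⇒ {true}  _ = inj₁ refl
∨-true⇒ {false} e = inj₂ e

∨-zeroʳ′ : ∀ a → (a ∨ true) ≡ true
∨-zeroʳ′ true  = refl
∨-zeroʳ′ false = refl

≡ᵇ-refl : ∀ n → (n ≡ᵇ n) ≡ true
≡ᵇ-refl zero    = refl
≡ᵇ-refl (suc n) = ≡ᵇ-refl n

≡ᵇ-sym : ∀ m n → (m ≡ᵇ n) ≡ (n ≡ᵇ m)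
≡ᵇ-sym zero    zero    = refl
≡ᵇ-sym zero    (suc n) = refl
≡ᵇ-sym (suc m) zero    = refl
≡ᵇ-sym (suc m) (suc n) = ≡ᵇ-sym m n

≡ᵇ-true⇒≡ : ∀ {m n} → (m ≡ᵇ n) ≡ true → m ≡ n
≡ᵇ-true⇒≡ {m} {n} e = ≡ᵇ⇒≡ m n (Equivalence.from T-≡ e)

≡⇒≡ᵇ-true : ∀ {m n} → m ≡ n → (m ≡ᵇ n) ≡ true
≡⇒≡ᵇ-true {m} refl = ≡ᵇ-refl m

≢⇒≡ᵇ-false : ∀ {m n} → ¬ m ≡ n → (m ≡ᵇ n) ≡ false
≢⇒≡ᵇ-false {zero}  {zero}  m≢n = contradiction refl m≢n
≢⇒≡ᵇ-false {zero}  {suc n} _   = refl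
≢⇒≡ᵇ-false {suc m} {zero}  _   = refl
≢⇒≡ᵇ-false {suc m} {suc n} m≢n = ≢⇒≡ᵇ-false (m≢n ∘ cong suc)

<⇒<ᵇ-true : ∀ {m n} → m < n → (m <ᵇ n) ≡ true
<⇒<ᵇ-true m<n = Equivalence.to T-≡ (<⇒<ᵇ m<n)

≥⇒<ᵇ-false : ∀ {m n} → n ≤ m → (m <ᵇ n) ≡ false
≥⇒<ᵇ-false {m}     {zero}  _         = refl
≥⇒<ᵇ-false {suc m} {suc n} (s≤s n≤m) = ≥⇒<ᵇ-false n≤m

<ᵇ-true⇒< : ∀ {m n} → (m <ᵇ n) ≡ true → m < n
<ᵇ-true⇒< {m} {n} e = <ᵇ⇒< m n (Equivalence.from T-≡ e)

≤⇒≤ᵇ-true : ∀ {m n} → m ≤ n → (m ≤ᵇ n) ≡ true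
≤⇒≤ᵇ-true m≤n = Equivalence.to T-≡ (≤⇒≤ᵇ m≤n)

≤ᵇ-true⇒≤ : ∀ {m n} → (m ≤ᵇ n) ≡ true → m ≤ n
≤ᵇ-true⇒≤ {m} {n} e = ≤ᵇ⇒≤ m n (Equivalence.from T-≡ e)

≤ᵇ-suc : ∀ m n → (suc m ≤ᵇ suc n) ≡ (m ≤ᵇ n)
≤ᵇ-suc zero    n = refl
≤ᵇ-suc (suc m) n = refl

-- Finite sums

∑ : {A : Set} → List A → (A → ℕ) → ℕ
∑ []       f = 0
∑ (x ∷ xs) f = f x + ∑ xs f

module _ {A : Set} where

  ∑-++ : ∀ (xs ys : List A) f → ∑ (xs ++ ys) f ≡ ∑ xs f + ∑ ys f
  ∑-++ []       ys f = refl
  ∑-++ (x ∷ xs) ys f = trans (cong (f x +_) (∑-++ xs ys f)) (sym (+-assoc (f x) _ _))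

  ∑-cong : ∀ xs {f g : A → ℕ} → (∀ x → f x ≡ g x) → ∑ xs f ≡ ∑ xs g
  ∑-cong []       _ = refl
  ∑-cong (x ∷ xs) e = cong₂ _+_ (e x) (∑-cong xs e)

  ∑-congᴬ : ∀ {P : A → Set} xs {f g : A → ℕ} → All P xs → (∀ x → P x → f x ≡ g x) → ∑ xs f ≡ ∑ xs g
  ∑-congᴬ []       []       _ = refl
  ∑-congᴬ (x ∷ xs) (p ∷ ps) e = cong₂ _+_ (e x p) (∑-congᴬ xs ps e)

  ∑-zero : ∀ xs {f : A → ℕ} → (∀ x → f x ≡ 0) → ∑ xs f ≡ 0
  ∑-zero []       _ = refl
  ∑-zero (x ∷ xs) e = cong₂ _+_ (e x) (∑-zero xs e)

  ∑-zeroᴬ : ∀ {P : A → Set} xs {f : A → ℕ} → All P xs → (∀ x → P x → f x ≡ 0) → ∑ xs f ≡ 0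
  ∑-zeroᴬ []       []       _ = refl
  ∑-zeroᴬ (x ∷ xs) (p ∷ ps) e = cong₂ _+_ (e x p) (∑-zeroᴬ xs ps e)

  ∑-+ : ∀ xs (f g : A → ℕ) → ∑ xs (λ x → f x + g x) ≡ ∑ xs f + ∑ xs g
  ∑-+ []       f g = refl
  ∑-+ (x ∷ xs) f g = trans (cong (f x + g x +_) (∑-+ xs f g)) (lemma (f x) (g x) (∑ xs f) (∑ xs g))
    where
    lemma : ∀ a b c d → a + b + (c + d) ≡ a + c + (b + d)
    lemma = solve-∀

  ∑-*ˡ : ∀ c xs (f : A → ℕ) → ∑ xs (λ x → c * f x) ≡ c * ∑ xs f
  ∑-*ˡ c []       f = sym (*-zeroʳ c)
  ∑-*ˡ c (x ∷ xs) f = trans (cong (c * f x +_) (∑-*ˡ c xs f)) (sym (*-distribˡ-+ c (f x) (∑ xs f)))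

  length-filterᵇ : ∀ (p : A → Bool) xs → length (filterᵇ p xs) ≡ ∑ xs (𝟙 ∘ p)
  length-filterᵇ p []       = refl
  length-filterᵇ p (x ∷ xs) with p x
  ... | true  = cong suc (length-filterᵇ p xs)
  ... | false = length-filterᵇ p xs

∑-map : {A B : Set} (g : A → B) (xs : List A) (f : B → ℕ) → ∑ (map g xs) f ≡ ∑ xs (f ∘ g)
∑-map g []       f = refl
∑-map g (x ∷ xs) f = cong (f (g x) +_) (∑-map g xs f)

∑-concatMap : {A B : Set} (g : A → List B) (xs : List A) (f : B → ℕ) → ∑ (concatMap g xs) f ≡ ∑ xs (λ x → ∑ (g x) f)
∑-concatMap g []       f = refl
∑-concatMap g (x ∷ xs) f = trans (∑-++ (g x) (concatMap g xs) f) (cong (∑ (g x) f +_) (∑-concatMap g xs f))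

∑< : ℕ → (ℕ → ℕ) → ℕ
∑< zero    f = 0
∑< (suc n) f = f 0 + ∑< n (f ∘ suc)

∑<-cong : ∀ n {f g : ℕ → ℕ} → (∀ i → i < n → f i ≡ g i) → ∑< n f ≡ ∑< n g
∑<-cong zero    _ = refl
∑<-cong (suc n) e = cong₂ _+_ (e 0 (s≤s z≤n)) (∑<-cong n (λ i i<n → e (suc i) (s≤s i<n)))

∑<-zero : ∀ n {f : ℕ → ℕ} → (∀ i → f i ≡ 0) → ∑< n f ≡ 0
∑<-zero zero    _ = refl
∑<-zero (suc n) e = cong₂ _+_ (e 0) (∑<-zero n (e ∘ suc))

∑<-+ : ∀ n (f g : ℕ → ℕ) → ∑< n (λ i → f i + g i) ≡ ∑< n f + ∑< n g
∑<-+ zero    f g = refl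
∑<-+ (suc n) f g = trans (cong (f 0 + g 0 +_) (∑<-+ n (f ∘ suc) (g ∘ suc))) (lemma (f 0) (g 0) _ _)
  where
  lemma : ∀ a b c d → a + b + (c + d) ≡ a + c + (b + d)
  lemma = solve-∀

∑<-*ˡ : ∀ c n (f : ℕ → ℕ) → ∑< n (λ i → c * f i) ≡ c * ∑< n f
∑<-*ˡ c zero    f = sym (*-zeroʳ c)
∑<-*ˡ c (suc n) f = trans (cong (c * f 0 +_) (∑<-*ˡ c n (f ∘ suc))) (sym (*-distribˡ-+ c (f 0) _))

∑<-const : ∀ n c → ∑< n (λ _ → c) ≡ n * c
∑<-const zero    c = refl
∑<-const (suc n) c = cong (c +_) (∑<-const n c)

∑<-+-split : ∀ m n (f : ℕ → ℕ) → ∑< (m + n) f ≡ ∑< m f + ∑< n (λ i → f (m + i))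
∑<-+-split zero    n f = refl
∑<-+-split (suc m) n f = trans (cong (f 0 +_) (∑<-+-split m n (f ∘ suc))) (sym (+-assoc (f 0) _ _))

∑<-suc : ∀ n (f : ℕ → ℕ) → ∑< (suc n) f ≡ ∑< n f + f n
∑<-suc zero    f = +-comm (f 0) 0
∑<-suc (suc n) f = trans (cong (f 0 +_) (∑<-suc n (f ∘ suc))) (sym (+-assoc (f 0) _ _))

∑<-mono : ∀ {m n} (f : ℕ → ℕ) → m ≤ n → ∑< m f ≤ ∑< n f
∑<-mono {zero}          f _         = z≤n
∑<-mono {suc m} {suc n} f (s≤s m≤n) = +-monoʳ-≤ (f 0) (∑<-mono (f ∘ suc) m≤n)

∑<-∑ : {A : Set} → ∀ n (xs : List A) (h : ℕ → A → ℕ) → ∑< n (λ i → ∑ xs (h i)) ≡ ∑ xs (λ x → ∑< n (λ i → h i x))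
∑<-∑ zero    xs h = sym (∑-zero xs (λ _ → refl))
∑<-∑ (suc n) xs h = trans (cong (∑ xs (h 0) +_) (∑<-∑ n xs (h ∘ suc))) (sym (∑-+ xs (h 0) (λ x → ∑< n (λ i → h (suc i) x))))

count-cons : ∀ x y w → count x (y ∷ w) ≡ 𝟙 (x ≡ᵇ y) + count x w
count-cons x y w with x ≡ᵇ y
... | true  = refl
... | false = refl

count-++ : ∀ x u v → count x (u ++ v) ≡ count x u + count x v
count-++ x []      v = refl
count-++ x (y ∷ u) v = begin
  count x (y ∷ u ++ v)                ≡⟨ count-cons x y (u ++ v) ⟩
  𝟙 (x ≡ᵇ y) + count x (u ++ v)       ≡⟨ cong (𝟙 (x ≡ᵇ y) +_) (count-++ x u v) ⟩
  𝟙 (x ≡ᵇ y) + (count x u + count x v) ≡⟨ +-assoc (𝟙 (x ≡ᵇ y)) _ _ ⟨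
  𝟙 (x ≡ᵇ y) + count x u + count x v   ≡⟨ cong (_+ count x v) (count-cons x y u) ⟨
  count x (y ∷ u) + count x v          ∎

count-∉ : ∀ x w → (x ∈ᵇ w) ≡ false → count x w ≡ 0
count-∉ x []      _ = refl
count-∉ x (y ∷ w) e with x ≡ᵇ y
... | false = count-∉ x w e

∈ᵇ-head : ∀ y w → (y ∈ᵇ (y ∷ w)) ≡ true
∈ᵇ-head y w rewrite ≡ᵇ-refl y = refl

∈ᵇ-tail : ∀ x y w → (x ∈ᵇ w) ≡ true → (x ∈ᵇ (y ∷ w)) ≡ true
∈ᵇ-tail x y w e rewrite e = ∨-zeroʳ′ (x ≡ᵇ y)

All-∈ᵇ : ∀ {P : ℕ → Set} w → All P w → ∀ x → (x ∈ᵇ w) ≡ true → P x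
All-∈ᵇ (y ∷ w) (p ∷ ps) x e with x ≡ᵇ y in x≡y
... | true rewrite ≡ᵇ-true⇒≡ {x} {y} x≡y = p
... | false = All-∈ᵇ w ps x e

∈ᵇ-All : ∀ {P : ℕ → Set} w → (∀ x → (x ∈ᵇ w) ≡ true → P x) → All P w
∈ᵇ-All []      _ = []
∈ᵇ-All (y ∷ w) h = h y (∈ᵇ-head y w) ∷ ∈ᵇ-All w (λ x e → h x (∈ᵇ-tail x y w e))

all-true : ∀ {A : Set} (p : A → Bool) xs → All (λ x → p x ≡ true) xs → all p xs ≡ true
all-true p []       []       = refl
all-true p (x ∷ xs) (e ∷ es) rewrite e = all-true p xs es

all-++ : ∀ {A : Set} (p : A → Bool) u v → all p (u ++ v) ≡ all p u ∧ all p v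
all-++ p []      v = refl
all-++ p (y ∷ u) v rewrite all-++ p u v = sym (∧-assoc (p y) (all p u) (all p v))

all-cong : ∀ {A : Set} (p q : A → Bool) xs → All (λ x → p x ≡ q x) xs → all p xs ≡ all q xs
all-cong p q []       []       = refl
all-cong p q (x ∷ xs) (e ∷ es) = cong₂ _∧_ e (all-cong p q xs es)

all-true-∈ᵇ : ∀ (p : ℕ → Bool) w → all p w ≡ true → ∀ x → (x ∈ᵇ w) ≡ true → p x ≡ true
all-true-∈ᵇ p w e = All-∈ᵇ w (go w e)
  where
  go : ∀ w → all p w ≡ true → All (λ x → p x ≡ true) w
  go []      _ = []
  go (y ∷ w) e = proj₁ (∧-true⇒ e) ∷ go w (proj₂ (∧-true⇒ {p y} e))

range1-suc : ∀ m → range1 (suc m) ≡ range1 m ++ suc m ∷ []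
range1-suc m = trans (cong (map suc) (sym (upTo-∷ʳ m))) (map-++ suc (upTo m) (m ∷ []))

range1-bounded : ∀ m → All (λ x → 1 ≤ x × x ≤ m) (range1 m)
range1-bounded zero    = []
range1-bounded (suc m) = subst (All (λ x → 1 ≤ x × x ≤ suc m)) (sym (range1-suc m))
  (++⁺ (All.map (λ (1≤x , x≤m) → 1≤x , m≤n⇒m≤1+n x≤m) (range1-bounded m)) ((s≤s z≤n , ≤-refl) ∷ []))

∑≡∑<-count : ∀ (L : List ℕ) B (h : ℕ → ℕ) → All (_< B) L → ∑ L h ≡ ∑< B (λ z → count z L * h z)
∑≡∑<-count []      B h []          = sym (∑<-zero B (λ _ → refl))
∑≡∑<-count (x ∷ L) B h (x<B ∷ L<B) = begin
  h x + ∑ L h                                                 ≡⟨ cong₂ _+_ (sym (∑<-𝟙≡ B x h x<B)) (∑≡∑<-count L B h L<B) ⟩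
  ∑< B (λ z → 𝟙 (z ≡ᵇ x) * h z) + ∑< B (λ z → count z L * h z) ≡⟨ ∑<-+ B _ _ ⟨
  ∑< B (λ z → 𝟙 (z ≡ᵇ x) * h z + count z L * h z)             ≡⟨ ∑<-cong B (λ z _ → sym (*-distribʳ-+ (h z) (𝟙 (z ≡ᵇ x)) (count z L))) ⟩
  ∑< B (λ z → (𝟙 (z ≡ᵇ x) + count z L) * h z)                 ≡⟨ ∑<-cong B (λ z _ → cong (_* h z) (count-cons z x L)) ⟨
  ∑< B (λ z → count z (x ∷ L) * h z)                          ∎
  where
  ∑<-𝟙≡ : ∀ B x (h : ℕ → ℕ) → x < B → ∑< B (λ z → 𝟙 (z ≡ᵇ x) * h z) ≡ h x
  ∑<-𝟙≡ (suc B) zero    h _         = trans (cong (h 0 + 0 +_) (∑<-zero B (λ _ → refl))) (trans (+-identityʳ _) (+-identityʳ _))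
  ∑<-𝟙≡ (suc B) (suc x) h (s≤s x<B) = ∑<-𝟙≡ B x (h ∘ suc) x<B

count-removeAll : ∀ y x L → count y (filter (λ z → ¬? (T? (x ≡ᵇ z))) L) ≡ (if y ≡ᵇ x then 0 else count y L)
count-removeAll y x L with y ≡ᵇ x in y≡x
... | true rewrite ≡ᵇ-true⇒≡ {y} {x} y≡x = removed L
  where
  removed : ∀ L → count x (filter (λ z → ¬? (T? (x ≡ᵇ z))) L) ≡ 0
  removed []      = refl
  removed (z ∷ L) with x ≡ᵇ z in x≡z
  ... | true  = removed L
  ... | false = trans (count-cons x z _) (cong₂ _+_ (cong 𝟙 x≡z) (removed L))
... | false = kept L
  where
  kept : ∀ L → count y (filter (λ z → ¬? (T? (x ≡ᵇ z))) L) ≡ count y L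
  kept []      = refl
  kept (z ∷ L) with x ≡ᵇ z in x≡z
  ... | true with ≡ᵇ-true⇒≡ {x} {z} x≡z
  ...   | refl = trans (kept L) (sym (trans (count-cons y x L) (cong (λ b → 𝟙 b + count y L) y≡x)))
  kept (z ∷ L) | false = trans (count-cons y z _) (trans (cong (𝟙 (y ≡ᵇ z) +_) (kept L)) (sym (count-cons y z L)))

count-distinct : ∀ w y → count y (distinct w) ≡ 𝟙 (y ∈ᵇ w)
count-distinct []      y = refl
count-distinct (x ∷ w) y = begin
  count y (distinct (x ∷ w))                                      ≡⟨ count-cons y x _ ⟩
  𝟙 (y ≡ᵇ x) + count y (filter (λ z → ¬? (T? (x ≡ᵇ z))) (distinct w)) ≡⟨ cong (𝟙 (y ≡ᵇ x) +_) (count-removeAll y x (distinct w)) ⟩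
  𝟙 (y ≡ᵇ x) + (if y ≡ᵇ x then 0 else count y (distinct w))        ≡⟨ lemma (y ≡ᵇ x) ⟩
  𝟙 (y ∈ᵇ (x ∷ w))                                                ∎
  where
  lemma : ∀ b → 𝟙 b + (if b then 0 else count y (distinct w)) ≡ 𝟙 (b ∨ (y ∈ᵇ w))
  lemma true  = refl
  lemma false = count-distinct w y

All-distinct : ∀ {P : ℕ → Set} w → All P w → All P (distinct w)
All-distinct []      []       = []
All-distinct (x ∷ w) (p ∷ ps) = p ∷ filter⁺ _ (All-distinct w ps)

-- Reduced cycles

paired : List ℕ → Bool
paired b = all (λ x → count x b ≡ᵇ 2) b

ComparesAlike : (ℕ → ℕ) → ℕ → ℕ → Set
ComparesAlike g x y = ((g x <ᵇ g y) ≡ (x <ᵇ y)) × ((g x ≡ᵇ g y) ≡ (x ≡ᵇ y))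

OrderEmbeddingOn : List ℕ → (ℕ → ℕ) → Set
OrderEmbeddingOn w g = ∀ x y → (x ∈ᵇ w) ≡ true → (y ∈ᵇ w) ≡ true → ComparesAlike g x y

betweenGreater-map : ∀ (g : ℕ → ℕ) w → OrderEmbeddingOn w g → betweenGreater (map g w) ≡ betweenGreater w
betweenGreater-map g []       _ = refl
betweenGreater-map g (x ∷ xs) H = cong₂ _∧_
  (cong₂ (λ a b → if a then b else true) (∈ᵇ-map xs (λ y y∈ → proj₂ (x-y y y∈))) (prefix xs (λ y y∈ → x-y y y∈ , y-x y y∈)))
  (betweenGreater-map g xs (λ a b a∈ b∈ → H a b (∈ᵇ-tail a x xs a∈) (∈ᵇ-tail b x xs b∈)))
  where
  x-y : ∀ y → (y ∈ᵇ xs) ≡ true → ComparesAlike g x y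
  x-y y y∈ = H x y (∈ᵇ-head x xs) (∈ᵇ-tail y x xs y∈)
  y-x : ∀ y → (y ∈ᵇ xs) ≡ true → ComparesAlike g y x
  y-x y y∈ = H y x (∈ᵇ-tail y x xs y∈) (∈ᵇ-head x xs)
  ∈ᵇ-map : ∀ ys → (∀ y → (y ∈ᵇ ys) ≡ true → (g x ≡ᵇ g y) ≡ (x ≡ᵇ y)) → (g x ∈ᵇ map g ys) ≡ (x ∈ᵇ ys)
  ∈ᵇ-map []       _ = refl
  ∈ᵇ-map (y ∷ ys) h = cong₂ _∨_ (h y (∈ᵇ-head y ys)) (∈ᵇ-map ys (λ z e → h z (∈ᵇ-tail z y ys e)))
  prefix : ∀ ys → (∀ y → (y ∈ᵇ ys) ≡ true → ComparesAlike g x y × ComparesAlike g y x) →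
           all (g x <ᵇ_) (takeWhileᵇ (λ y → not (y ≡ᵇ g x)) (map g ys)) ≡ all (x <ᵇ_) (takeWhileᵇ (λ y → not (y ≡ᵇ x)) ys)
  prefix []       _ = refl
  prefix (y ∷ ys) h with h y (∈ᵇ-head y ys)
  ... | (gx<gy , _) , (_ , gy≡gx) rewrite gy≡gx with y ≡ᵇ x
  ... | true  = refl
  ... | false = cong₂ _∧_ gx<gy (prefix ys (λ z e → h z (∈ᵇ-tail z y ys e)))

-- red w replaces x by 1 + rank x. Computing rank x as the prefix sum ∑< x χ of the indicator χ of
-- the entries of w makes both its strict monotonicity and the multiplicities in red w transparent.

module Rank (w : List ℕ) where

  bound : ℕ
  bound = suc (sum w)

  <bound : All (_< bound) w
  <bound = go w
    where
    go : ∀ w → All (_< suc (sum w)) w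
    go []      = []
    go (y ∷ w) = s≤s (m≤m+n y (sum w)) ∷ All.map (λ h → ≤-trans h (s≤s (m≤n+m (sum w) y))) (go w)

  χ : ℕ → ℕ
  χ z = 𝟙 (z ∈ᵇ w)

  rank : ℕ → ℕ
  rank x = ∑< x χ

  letter : ℕ → ℕ
  letter x = suc (length (filterᵇ (_<ᵇ x) (distinct w)))

  letter≡suc-rank : ∀ x → (x ∈ᵇ w) ≡ true → letter x ≡ suc (rank x)
  letter≡suc-rank x x∈w = cong suc (begin
    length (filterᵇ (_<ᵇ x) (distinct w))                    ≡⟨ length-filterᵇ (_<ᵇ x) (distinct w) ⟩
    ∑ (distinct w) (λ z → 𝟙 (z <ᵇ x))                        ≡⟨ ∑≡∑<-count (distinct w) bound _ (All-distinct w <bound) ⟩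
    ∑< bound (λ z → count z (distinct w) * 𝟙 (z <ᵇ x))       ≡⟨ ∑<-cong bound (λ z _ → cong (_* 𝟙 (z <ᵇ x)) (count-distinct w z)) ⟩
    ∑< bound (λ z → χ z * 𝟙 (z <ᵇ x))                        ≡⟨ ∑<-below bound x χ (<⇒≤ (All-∈ᵇ w <bound x x∈w)) ⟩
    rank x                                                   ∎)
    where
    ∑<-below : ∀ B x (f : ℕ → ℕ) → x ≤ B → ∑< B (λ z → f z * 𝟙 (z <ᵇ x)) ≡ ∑< x f
    ∑<-below B       zero    f _         = ∑<-zero B (λ i → *-zeroʳ (f i))
    ∑<-below (suc B) (suc x) f (s≤s x≤B) = cong₂ _+_ (*-identityʳ (f 0)) (∑<-below B x (f ∘ suc) x≤B)

  rank-strict : ∀ x y → (x ∈ᵇ w) ≡ true → x < y → rank x < rank y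
  rank-strict x y x∈w x<y = <-≤-trans rank<rank-suc (∑<-mono χ x<y)
    where
    rank<rank-suc : rank x < rank (suc x)
    rank<rank-suc rewrite ∑<-suc x χ | x∈w = m<m+n (rank x) (s≤s z≤n)

  rank-embedding : OrderEmbeddingOn w rank
  rank-embedding x y x∈w y∈w with <-cmp x y
  ... | tri< x<y _ _ = trans (<⇒<ᵇ-true (rank-strict x y x∈w x<y)) (sym (<⇒<ᵇ-true x<y))
                     , trans (≢⇒≡ᵇ-false (<⇒≢ (rank-strict x y x∈w x<y))) (sym (≢⇒≡ᵇ-false (<⇒≢ x<y)))
  ... | tri≈ _ refl _ = trans (≥⇒<ᵇ-false (≤-refl {rank x})) (sym (≥⇒<ᵇ-false (≤-refl {x})))
                      , trans (≡ᵇ-refl (rank x)) (sym (≡ᵇ-refl x))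
  ... | tri> _ _ y<x = trans (≥⇒<ᵇ-false (<⇒≤ (rank-strict y x y∈w y<x))) (sym (≥⇒<ᵇ-false (<⇒≤ y<x)))
                     , trans (≢⇒≡ᵇ-false (≢-sym (<⇒≢ (rank-strict y x y∈w y<x)))) (sym (≢⇒≡ᵇ-false (≢-sym (<⇒≢ y<x))))

  letter-embedding : OrderEmbeddingOn w letter
  letter-embedding x y x∈w y∈w =
    trans (cong₂ _<ᵇ_ (letter≡suc-rank x x∈w) (letter≡suc-rank y y∈w)) (proj₁ (rank-embedding x y x∈w y∈w)) ,
    trans (cong₂ _≡ᵇ_ (letter≡suc-rank x x∈w) (letter≡suc-rank y y∈w)) (proj₂ (rank-embedding x y x∈w y∈w))

  #prefixSum≡ : ∀ (c : ℕ → Bool) B t → ∑< B (λ z → 𝟙 (c z) * 𝟙 (t ≡ᵇ ∑< z (𝟙 ∘ c))) ≡ 𝟙 (t <ᵇ ∑< B (𝟙 ∘ c))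
  #prefixSum≡ c zero    t = refl
  #prefixSum≡ c (suc B) t = begin
    ∑< (suc B) F                            ≡⟨ ∑<-suc B F ⟩
    ∑< B F + F B                            ≡⟨ cong (_+ F B) (#prefixSum≡ c B t) ⟩
    𝟙 (t <ᵇ R) + 𝟙 (c B) * 𝟙 (t ≡ᵇ R)       ≡⟨ step (c B) ⟩
    𝟙 (t <ᵇ R + 𝟙 (c B))                   ≡⟨ cong (λ z → 𝟙 (t <ᵇ z)) (∑<-suc B (𝟙 ∘ c)) ⟨
    𝟙 (t <ᵇ ∑< (suc B) (𝟙 ∘ c))            ∎
    where
    R : ℕ
    R = ∑< B (𝟙 ∘ c)
    F : ℕ → ℕ
    F z = 𝟙 (c z) * 𝟙 (t ≡ᵇ ∑< z (𝟙 ∘ c))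
    <ᵇ-suc : ∀ t r → 𝟙 (t <ᵇ r) + 𝟙 (t ≡ᵇ r) ≡ 𝟙 (t <ᵇ suc r)
    <ᵇ-suc zero    zero    = refl
    <ᵇ-suc zero    (suc r) = refl
    <ᵇ-suc (suc t) zero    = refl
    <ᵇ-suc (suc t) (suc r) = <ᵇ-suc t r
    step : ∀ b → 𝟙 (t <ᵇ R) + 𝟙 b * 𝟙 (t ≡ᵇ R) ≡ 𝟙 (t <ᵇ R + 𝟙 b)
    step false rewrite +-identityʳ R = +-identityʳ _
    step true  rewrite +-identityʳ (𝟙 (t ≡ᵇ R)) | +-comm R 1 = <ᵇ-suc t R

  module Paired (w-paired : paired w ≡ true) where

    distinctCount : ℕ
    distinctCount = rank bound

    count≡2χ : ∀ z → count z w ≡ 2 * χ z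
    count≡2χ z with z ∈ᵇ w in z∈w
    ... | true  = ≡ᵇ-true⇒≡ (all-true-∈ᵇ (λ x → count x w ≡ᵇ 2) w w-paired z z∈w)
    ... | false = count-∉ z w z∈w

    length≡ : length w ≡ 2 * distinctCount
    length≡ = begin
      length w                        ≡⟨ length-∑ w ⟩
      ∑ w (λ _ → 1)                   ≡⟨ ∑≡∑<-count w bound (λ _ → 1) <bound ⟩
      ∑< bound (λ z → count z w * 1)  ≡⟨ ∑<-cong bound (λ z _ → trans (*-identityʳ _) (count≡2χ z)) ⟩
      ∑< bound (λ z → 2 * χ z)        ≡⟨ ∑<-*ˡ 2 bound χ ⟩
      2 * distinctCount               ∎
      where
      length-∑ : ∀ (w : List ℕ) → length w ≡ ∑ w (λ _ → 1)
      length-∑ []      = refl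
      length-∑ (y ∷ w) = cong suc (length-∑ w)

    length/2≡ : length w / 2 ≡ distinctCount
    length/2≡ rewrite length≡ | *-comm 2 distinctCount = m*n/n≡m distinctCount 2

    count-red : ∀ t → count (suc t) (red w) ≡ 2 * 𝟙 (t <ᵇ distinctCount)
    count-red t = begin
      count (suc t) (map letter w)
        ≡⟨ length-filterᵇ (suc t ≡ᵇ_) (map letter w) ⟩
      ∑ (map letter w) (λ v → 𝟙 (suc t ≡ᵇ v))
        ≡⟨ ∑-map letter w _ ⟩
      ∑ w (λ x → 𝟙 (suc t ≡ᵇ letter x))
        ≡⟨ ∑-congᴬ w (∈ᵇ-All w (λ x e → e)) (λ x x∈w → cong (λ v → 𝟙 (suc t ≡ᵇ v)) (letter≡suc-rank x x∈w)) ⟩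
      ∑ w (λ x → 𝟙 (t ≡ᵇ rank x))
        ≡⟨ ∑≡∑<-count w bound _ <bound ⟩
      ∑< bound (λ z → count z w * 𝟙 (t ≡ᵇ rank z))
        ≡⟨ ∑<-cong bound (λ z _ → trans (cong (_* 𝟙 (t ≡ᵇ rank z)) (count≡2χ z)) (*-assoc 2 (χ z) _)) ⟩
      ∑< bound (λ z → 2 * (χ z * 𝟙 (t ≡ᵇ rank z)))
        ≡⟨ ∑<-*ˡ 2 bound (λ z → χ z * 𝟙 (t ≡ᵇ rank z)) ⟩
      2 * ∑< bound (λ z → χ z * 𝟙 (t ≡ᵇ rank z))
        ≡⟨ cong (2 *_) (#prefixSum≡ (_∈ᵇ w) bound t) ⟩
      2 * 𝟙 (t <ᵇ distinctCount) ∎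

    letters-bounded : All (λ x → ((1 ≤ᵇ x) ∧ (x ≤ᵇ distinctCount)) ≡ true) (red w)
    letters-bounded = map⁺ (∈ᵇ-All w (λ x x∈w → trans (cong (_≤ᵇ distinctCount) (letter≡suc-rank x x∈w))
                              (≤⇒≤ᵇ-true (rank-strict x bound x∈w (All-∈ᵇ w <bound x x∈w)))))

    counts-red : All (λ i → (count i (red w) ≡ᵇ 2) ≡ true) (range1 distinctCount)
    counts-red = All.map (λ { {suc t} (_ , t<d) → cong (_≡ᵇ 2) (trans (count-red t) (cong (λ b → 2 * 𝟙 b) (<⇒<ᵇ-true t<d))) })
                         (range1-bounded distinctCount)

    red-isPerm : isPermOf[ distinctCount ]₂ (red w) ≡ true
    red-isPerm rewrite length-map letter w | length≡ | ≡ᵇ-refl (2 * distinctCount)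
                     | all-true (λ x → (1 ≤ᵇ x) ∧ (x ≤ᵇ distinctCount)) (red w) letters-bounded
                     | all-true (λ i → count i (red w) ≡ᵇ 2) (range1 distinctCount) counts-red = refl

isCycle : List ℕ → Bool
isCycle []       = false
isCycle (c ∷ cs) = all (c ≤ᵇ_) (c ∷ cs) ∧ betweenGreater (c ∷ cs)

cycleOK≡isCycle : ∀ b → paired b ≡ true → cycleOK b ≡ isCycle b
cycleOK≡isCycle []       _ = refl
cycleOK≡isCycle (c ∷ cs) p = cong (all (c ≤ᵇ_) (c ∷ cs) ∧_) (begin
  isStirling (length (c ∷ cs) / 2) (red (c ∷ cs)) ≡⟨ cong (λ k → isStirling k (red (c ∷ cs))) length/2≡ ⟩
  isStirling distinctCount (red (c ∷ cs))         ≡⟨ cong (_∧ betweenGreater (red (c ∷ cs))) red-isPerm ⟩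
  betweenGreater (red (c ∷ cs))                   ≡⟨ betweenGreater-map letter (c ∷ cs) letter-embedding ⟩
  betweenGreater (c ∷ cs)                         ∎)
  where
  open Rank (c ∷ cs)
  open Paired p

isStirling2′ : ℕ → List (List ℕ) → Bool
isStirling2′ n cs = nonempty cs ∧ (isPermOf[ n ]₂ (concat cs) ∧ (copiesTogether cs ∧ (all isCycle cs ∧ increasingFirsts cs)))

all-cycleOK≡all-isCycle : ∀ cs → copiesTogether cs ≡ true → all cycleOK cs ≡ all isCycle cs
all-cycleOK≡all-isCycle []       _ = refl
all-cycleOK≡all-isCycle (c ∷ cs) e =
  cong₂ _∧_ (cycleOK≡isCycle c (proj₁ (∧-true⇒ e))) (all-cycleOK≡all-isCycle cs (proj₂ (∧-true⇒ {paired c} e)))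

isStirling2≡isStirling2′ : ∀ n cs → isStirling2 n cs ≡ isStirling2′ n cs
isStirling2≡isStirling2′ n cs with copiesTogether cs in together
... | true  rewrite all-cycleOK≡all-isCycle cs together = refl
... | false = refl

-- Segmentations

Segmentation : Set
Segmentation = List (List ℕ)

extend : ℕ → Segmentation → List Segmentation
extend x []       = ((x ∷ []) ∷ []) ∷ []
extend x (b ∷ bs) = ((x ∷ []) ∷ b ∷ bs) ∷ ((x ∷ b) ∷ bs) ∷ []

segmentations-∷ : ∀ x xs → segmentations (x ∷ xs) ≡ concatMap (extend x) (segmentations xs)
segmentations-∷ x xs = concatMap-cong (λ { [] → refl ; (b ∷ bs) → refl }) (segmentations xs)

∑-segmentations-∷ : ∀ x xs (f : Segmentation → ℕ) →
  ∑ (segmentations (x ∷ xs)) f ≡ ∑ (segmentations xs) (λ s → ∑ (extend x s) f)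
∑-segmentations-∷ x xs f = trans (cong (λ L → ∑ L f) (segmentations-∷ x xs)) (∑-concatMap (extend x) (segmentations xs) f)

Nonempty : Segmentation → Set
Nonempty = All (λ b → nonempty b ≡ true)

IsSegmentationOf : List ℕ → Segmentation → Set
IsSegmentationOf w s = concat s ≡ w × Nonempty s

segmentations-sound : ∀ w → All (IsSegmentationOf w) (segmentations w)
segmentations-sound []       = (refl , []) ∷ []
segmentations-sound (x ∷ xs) =
  subst (All (IsSegmentationOf (x ∷ xs))) (sym (segmentations-∷ x xs))
        (concat⁺ (map⁺ (All.map extend-sound (segmentations-sound xs))))
  where
  extend-sound : ∀ {s} → IsSegmentationOf xs s → All (IsSegmentationOf (x ∷ xs)) (extend x s)
  extend-sound {[]}     (refl , [])     = (refl , refl ∷ []) ∷ []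
  extend-sound {b ∷ bs} (refl , b≢[] ∷ bs≢[]) = (refl , refl ∷ b≢[] ∷ bs≢[]) ∷ (refl , refl ∷ bs≢[]) ∷ []

-- Segmentations of words in which the letter N occurs exactly twice, adjacently.

module Pair (N : ℕ) where

  noN : List ℕ → Bool
  noN = all (λ y → not (y ≡ᵇ N))

  NoN : List ℕ → Set
  NoN = All (λ y → (y ≡ᵇ N) ≡ false)

  NoN⇒noN : ∀ {w} → NoN w → noN w ≡ true
  NoN⇒noN []         = refl
  NoN⇒noN (y≢N ∷ ys) rewrite y≢N = NoN⇒noN ys

  noN-concat : ∀ s → all noN s ≡ noN (concat s)
  noN-concat []       = refl
  noN-concat (b ∷ bs) rewrite noN-concat bs = sym (all-++ (λ y → not (y ≡ᵇ N)) b (concat bs))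

  pairThenNoN : List ℕ → Bool
  pairThenNoN []      = false
  pairThenNoN (z ∷ q) = (z ≡ᵇ N) ∧ noN q

  -- onePair w holds iff w = u ++ N ∷ N ∷ v with u and v free of N
  onePair : List ℕ → Bool
  onePair []      = false
  onePair (y ∷ r) = if y ≡ᵇ N then pairThenNoN r else onePair r

  pairInside : List ℕ → Bool
  pairInside []      = false
  pairInside (x ∷ r) = not (x ≡ᵇ N) ∧ onePair r

  isPairCycle : List ℕ → Bool
  isPairCycle (a ∷ c ∷ []) = (a ≡ᵇ N) ∧ (c ≡ᵇ N)
  isPairCycle _            = false

  -- the pair sits in an admissible place of a Stirling permutation: a final cycle (N N),
  -- or inside a cycle, after its first entry
  admissible : Segmentation → Bool
  admissible []       = false
  admissible (b ∷ bs) = (isPairCycle b ∧ null bs) ∨ ((noN b ∧ admissible bs) ∨ (pairInside b ∧ all noN bs))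

  -- the first cycle starts with the pair but is not the only cycle (N N):
  -- prepending an entry to the first cycle makes the pair admissible
  pairLeads : Segmentation → Bool
  pairLeads ((a ∷ c ∷ q) ∷ bs) = (a ≡ᵇ N) ∧ ((c ≡ᵇ N) ∧ (noN q ∧ (all noN bs ∧ (nonempty q ∨ nonempty bs))))
  pairLeads _                  = false

  isPairCycle-≢ : ∀ x r → (x ≡ᵇ N) ≡ false → isPairCycle (x ∷ r) ≡ false
  isPairCycle-≢ x []            _   = refl
  isPairCycle-≢ x (c ∷ [])      x≢N rewrite x≢N = refl
  isPairCycle-≢ x (c ∷ d ∷ r)   _   = refl

  pairLeads-≢ : ∀ x r bs → (x ≡ᵇ N) ≡ false → pairLeads ((x ∷ r) ∷ bs) ≡ false
  pairLeads-≢ x []      bs _   = refl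
  pairLeads-≢ x (c ∷ q) bs x≢N rewrite x≢N = refl

  admissible-single : ∀ x s → (x ≡ᵇ N) ≡ false → admissible ((x ∷ []) ∷ s) ≡ admissible s
  admissible-single x s x≢N rewrite x≢N = ∨-identityʳ (admissible s)

  admissible-join : ∀ x b bs → (x ≡ᵇ N) ≡ false →
    𝟙 (admissible ((x ∷ b) ∷ bs)) ≡ 𝟙 (admissible (b ∷ bs)) + 𝟙 (pairLeads (b ∷ bs))
  admissible-join x b bs x≢N rewrite isPairCycle-≢ x b x≢N | x≢N = go b
    where
    go : ∀ b → 𝟙 ((noN b ∧ admissible bs) ∨ (onePair b ∧ all noN bs)) ≡ 𝟙 (admissible (b ∷ bs)) + 𝟙 (pairLeads (b ∷ bs))
    go [] = sym (+-identityʳ _)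
    go (y ∷ r) with y ≡ᵇ N in y≡N
    ... | false rewrite isPairCycle-≢ y r y≡N | pairLeads-≢ y r bs y≡N = sym (+-identityʳ _)
    ... | true with ≡ᵇ-true⇒≡ {y} {N} y≡N
    ...   | refl = lead r bs
      where
      lead : ∀ r bs → 𝟙 (pairThenNoN r ∧ all noN bs)
                      ≡ 𝟙 ((isPairCycle (N ∷ r) ∧ null bs) ∨ false) + 𝟙 (pairLeads ((N ∷ r) ∷ bs))
      lead []      bs = refl
      lead (c ∷ q) bs with c ≡ᵇ N in c≡N
      lead (c ∷ [])    bs       | false rewrite ≡ᵇ-refl N | c≡N = refl
      lead (c ∷ d ∷ q) bs       | false rewrite ≡ᵇ-refl N = refl
      lead (c ∷ q)     bs       | true with ≡ᵇ-true⇒≡ {c} {N} c≡N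
      lead (c ∷ [])    []       | true | refl rewrite ≡ᵇ-refl N = refl
      lead (c ∷ [])    (d ∷ ds) | true | refl rewrite ≡ᵇ-refl N = cong 𝟙 (sym (∧-identityʳ _))
      lead (c ∷ d ∷ q) bs       | true | refl rewrite ≡ᵇ-refl N = cong (λ z → 𝟙 (noN (d ∷ q) ∧ z)) (sym (∧-identityʳ _))

  joinFirst : ℕ → Segmentation → Segmentation
  joinFirst x []       = (x ∷ []) ∷ []
  joinFirst x (b ∷ bs) = (x ∷ b) ∷ bs

  ∑-extend-admissible : ∀ x s (f : Segmentation → ℕ) → (x ≡ᵇ N) ≡ false →
    ∑ (extend x s) (λ t → 𝟙 (admissible t) * f t)
    ≡ 𝟙 (admissible s) * (f ((x ∷ []) ∷ s) + f (joinFirst x s)) + 𝟙 (pairLeads s) * f (joinFirst x s)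
  ∑-extend-admissible x []       f x≢N rewrite admissible-single x [] x≢N = refl
  ∑-extend-admissible x (b ∷ bs) f x≢N rewrite admissible-single x (b ∷ bs) x≢N | admissible-join x b bs x≢N =
    lemma (𝟙 (admissible (b ∷ bs))) (𝟙 (pairLeads (b ∷ bs))) _ _
    where
    lemma : ∀ a c f₁ f₂ → a * f₁ + ((a + c) * f₂ + 0) ≡ a * (f₁ + f₂) + c * f₂
    lemma = solve-∀

  ∑-extend-pairLeads : ∀ x s (f : Segmentation → ℕ) → (x ≡ᵇ N) ≡ false → ∑ (extend x s) (λ t → 𝟙 (pairLeads t) * f t) ≡ 0
  ∑-extend-pairLeads x []       f _   = refl
  ∑-extend-pairLeads x (b ∷ bs) f x≢N rewrite pairLeads-≢ x b bs x≢N = refl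

  insertPair : ℕ → List ℕ → List ℕ
  insertPair zero    w       = N ∷ N ∷ w
  insertPair (suc i) []      = N ∷ N ∷ []
  insertPair (suc i) (x ∷ w) = x ∷ insertPair i w

  insertPairInCycles : ℕ → Segmentation → Segmentation
  insertPairInCycles i []       = (N ∷ N ∷ []) ∷ []
  insertPairInCycles i (b ∷ bs) =
    if i ≤ᵇ length b then insertPair i b ∷ bs else b ∷ insertPairInCycles (i ∸ length b) bs

  appendPairCycle : Segmentation → Segmentation
  appendPairCycle s = s ++ (N ∷ N ∷ []) ∷ []

  insertPairInCycles-joinFirst : ∀ x i b bs →
    insertPairInCycles (suc i) ((x ∷ b) ∷ bs) ≡ joinFirst x (insertPairInCycles i (b ∷ bs))
  insertPairInCycles-joinFirst x zero    b bs = refl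
  insertPairInCycles-joinFirst x (suc i) b bs with i <ᵇ length b
  ... | true  = refl
  ... | false = refl

  -- f summed over the two segmentations of N ∷ N ∷ concat s in which the pair leads
  leadingPair : (Segmentation → ℕ) → Segmentation → ℕ
  leadingPair f []       = 0
  leadingPair f (b ∷ bs) = f ((N ∷ N ∷ []) ∷ b ∷ bs) + f ((N ∷ N ∷ b) ∷ bs)

  ∑-admissible-front : ∀ v (f : Segmentation → ℕ) →
    ∑ (segmentations (N ∷ N ∷ v)) (λ s → 𝟙 (admissible s) * f s) ≡ ∑ (segmentations v) (λ s → 𝟙 (null v) * f (appendPairCycle s))
  ∑-admissible-front v f = begin
    ∑ (segmentations (N ∷ N ∷ v)) F                                      ≡⟨ ∑-segmentations-∷ N (N ∷ v) F ⟩
    ∑ (segmentations (N ∷ v)) (λ s → ∑ (extend N s) F)                   ≡⟨ ∑-segmentations-∷ N v _ ⟩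
    ∑ (segmentations v) (λ s → ∑ (extend N s) (λ t → ∑ (extend N t) F)) ≡⟨ ∑-congᴬ (segmentations v) (segmentations-sound v) (twice v) ⟩
    ∑ (segmentations v) (λ s → 𝟙 (null v) * f (appendPairCycle s))      ∎
    where
    F : Segmentation → ℕ
    F s = 𝟙 (admissible s) * f s
    twice : ∀ v s → IsSegmentationOf v s →
            ∑ (extend N s) (λ t → ∑ (extend N t) F) ≡ 𝟙 (null v) * f (appendPairCycle s)
    twice .[] []               (refl , [])    rewrite ≡ᵇ-refl N = lemma (f ((N ∷ N ∷ []) ∷ []))
      where
      lemma : ∀ p → 0 + (1 * p + 0) + 0 ≡ 1 * p
      lemma = solve-∀
    twice _   ([] ∷ bs)        (_ , () ∷ _)
    twice _   ((c ∷ b) ∷ bs)   (refl , _)     rewrite ≡ᵇ-refl N = refl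

  ∑-pairLeads-front : ∀ v → NoN v → (f : Segmentation → ℕ) →
    ∑ (segmentations (N ∷ N ∷ v)) (λ s → 𝟙 (pairLeads s) * f s) ≡ ∑ (segmentations v) (leadingPair f)
  ∑-pairLeads-front v v≢N f = begin
    ∑ (segmentations (N ∷ N ∷ v)) F                                      ≡⟨ ∑-segmentations-∷ N (N ∷ v) F ⟩
    ∑ (segmentations (N ∷ v)) (λ s → ∑ (extend N s) F)                   ≡⟨ ∑-segmentations-∷ N v _ ⟩
    ∑ (segmentations v) (λ s → ∑ (extend N s) (λ t → ∑ (extend N t) F)) ≡⟨ ∑-congᴬ (segmentations v) (segmentations-sound v) (twice v v≢N) ⟩
    ∑ (segmentations v) (leadingPair f)                                 ∎
    where
    F : Segmentation → ℕ
    F s = 𝟙 (pairLeads s) * f s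
    twice : ∀ v → NoN v → ∀ s → IsSegmentationOf v s → ∑ (extend N s) (λ t → ∑ (extend N t) F) ≡ leadingPair f s
    twice .[] _ [] (refl , []) rewrite ≡ᵇ-refl N = refl
    twice _ _ ([] ∷ bs) (_ , () ∷ _)
    twice _ (c≢N ∷ cs≢N) ((c ∷ b) ∷ bs) (refl , _) with ++⁻ b cs≢N
    ... | b≢N , bs≢N rewrite ≡ᵇ-refl N | c≢N | NoN⇒noN b≢N | trans (noN-concat bs) (NoN⇒noN bs≢N) =
      lemma (f ((N ∷ N ∷ []) ∷ (c ∷ b) ∷ bs)) (f ((N ∷ N ∷ c ∷ b) ∷ bs))
      where
      lemma : ∀ p q → 1 * p + 0 + (1 * q + 0 + 0) ≡ p + q
      lemma = solve-∀

  ∑-pairLeads : ∀ u v → NoN u → NoN v → (f : Segmentation → ℕ) →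
    ∑ (segmentations (u ++ N ∷ N ∷ v)) (λ s → 𝟙 (pairLeads s) * f s) ≡ 𝟙 (null u) * ∑ (segmentations v) (leadingPair f)
  ∑-pairLeads []      v _           v≢N f = trans (∑-pairLeads-front v v≢N f) (sym (*-identityˡ _))
  ∑-pairLeads (x ∷ u) v (x≢N ∷ u≢N) v≢N f =
    trans (∑-segmentations-∷ x (u ++ N ∷ N ∷ v) _) (∑-zero (segmentations (u ++ N ∷ N ∷ v)) (λ s → ∑-extend-pairLeads x s f x≢N))

  ∑-admissible : ∀ u v → NoN u → NoN v → (f : Segmentation → ℕ) →
    ∑ (segmentations (u ++ N ∷ N ∷ v)) (λ s → 𝟙 (admissible s) * f s)
    ≡ ∑ (segmentations (u ++ v)) (λ s → 𝟙 (nonempty u) * f (insertPairInCycles (length u) s) + 𝟙 (null v) * f (appendPairCycle s))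
  ∑-admissible []      v _           _   f = ∑-admissible-front v f
  ∑-admissible (x ∷ u) v (x≢N ∷ u≢N) v≢N f = begin
    ∑ (segmentations (x ∷ u ++ N ∷ N ∷ v)) F
      ≡⟨ ∑-segmentations-∷ x (u ++ N ∷ N ∷ v) F ⟩
    ∑ (segmentations (u ++ N ∷ N ∷ v)) (λ s → ∑ (extend x s) F)
      ≡⟨ ∑-cong (segmentations (u ++ N ∷ N ∷ v)) (λ s → ∑-extend-admissible x s f x≢N) ⟩
    ∑ (segmentations (u ++ N ∷ N ∷ v)) (λ s → 𝟙 (admissible s) * G s + 𝟙 (pairLeads s) * K s)
      ≡⟨ ∑-+ (segmentations (u ++ N ∷ N ∷ v)) _ _ ⟩
    ∑ (segmentations (u ++ N ∷ N ∷ v)) (λ s → 𝟙 (admissible s) * G s) + ∑ (segmentations (u ++ N ∷ N ∷ v)) (λ s → 𝟙 (pairLeads s) * K s)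
      ≡⟨ cong₂ _+_ (∑-admissible u v u≢N v≢N G) (∑-pairLeads u v u≢N v≢N K) ⟩
    ∑ (segmentations (u ++ v)) (λ s → 𝟙 (nonempty u) * G (insertPairInCycles (length u) s) + 𝟙 (null v) * G (appendPairCycle s))
      + 𝟙 (null u) * ∑ (segmentations v) (leadingPair K)
      ≡⟨ regroup u ⟩
    ∑ (segmentations (x ∷ u ++ v)) H ∎
    where
    F : Segmentation → ℕ
    F s = 𝟙 (admissible s) * f s
    G : Segmentation → ℕ
    G t = f ((x ∷ []) ∷ t) + f (joinFirst x t)
    K : Segmentation → ℕ
    K t = f (joinFirst x t)
    H : Segmentation → ℕ
    H s = 1 * f (insertPairInCycles (suc (length u)) s) + 𝟙 (null v) * f (appendPairCycle s)
    -- x becomes a cycle of its own or joins the first cycle; if the pair led, only the latter is admissible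
    leading : ∀ v s → IsSegmentationOf v s →
      (𝟙 (null v) * G (appendPairCycle s)) + 1 * leadingPair K s
      ≡ ∑ (extend x s) (λ s → 1 * f (insertPairInCycles 1 s) + 𝟙 (null v) * f (appendPairCycle s))
    leading .[] [] (refl , []) = lemma (f ((x ∷ []) ∷ (N ∷ N ∷ []) ∷ [])) (f ((x ∷ N ∷ N ∷ []) ∷ []))
      where
      lemma : ∀ p q → 1 * (p + q) + 1 * 0 ≡ 1 * q + 1 * p + 0
      lemma = solve-∀
    leading _ ([] ∷ bs) (_ , () ∷ _)
    leading .(concat ((c ∷ b) ∷ bs)) ((c ∷ b) ∷ bs) (refl , _) =
      lemma (f ((x ∷ N ∷ N ∷ []) ∷ (c ∷ b) ∷ bs)) (f ((x ∷ N ∷ N ∷ c ∷ b) ∷ bs))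
      where
      lemma : ∀ p q → 1 * (p + q) ≡ (1 * p + 0) + ((1 * q + 0) + 0)
      lemma = solve-∀
    inner : ∀ y u′ s → IsSegmentationOf ((y ∷ u′) ++ v) s →
      1 * G (insertPairInCycles (suc (length u′)) s) + 𝟙 (null v) * G (appendPairCycle s)
      ≡ ∑ (extend x s) (λ s → 1 * f (insertPairInCycles (suc (suc (length u′))) s) + 𝟙 (null v) * f (appendPairCycle s))
    inner y u′ []       (() , _)
    inner y u′ (b ∷ bs) _ rewrite insertPairInCycles-joinFirst x (suc (length u′)) b bs =
      lemma (𝟙 (null v)) (f ((x ∷ []) ∷ insertPairInCycles (suc (length u′)) (b ∷ bs))) (f (joinFirst x (insertPairInCycles (suc (length u′)) (b ∷ bs))))
            (f ((x ∷ []) ∷ appendPairCycle (b ∷ bs))) (f (joinFirst x (appendPairCycle (b ∷ bs))))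
      where
      lemma : ∀ e p₁ p₂ q₁ q₂ → 1 * (p₁ + p₂) + e * (q₁ + q₂) ≡ (1 * p₁ + e * q₁) + ((1 * p₂ + e * q₂) + 0)
      lemma = solve-∀
    regroup : ∀ u →
      ∑ (segmentations (u ++ v)) (λ s → 𝟙 (nonempty u) * G (insertPairInCycles (length u) s) + 𝟙 (null v) * G (appendPairCycle s))
        + 𝟙 (null u) * ∑ (segmentations v) (leadingPair K)
      ≡ ∑ (segmentations (x ∷ u ++ v)) (λ s → 1 * f (insertPairInCycles (suc (length u)) s) + 𝟙 (null v) * f (appendPairCycle s))
    regroup [] = begin
      ∑ (segmentations v) (λ s → 𝟙 (null v) * G (appendPairCycle s)) + 1 * ∑ (segmentations v) (leadingPair K)
        ≡⟨ cong (∑ (segmentations v) (λ s → 𝟙 (null v) * G (appendPairCycle s)) +_) (sym (∑-*ˡ 1 (segmentations v) (leadingPair K))) ⟩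
      ∑ (segmentations v) (λ s → 𝟙 (null v) * G (appendPairCycle s)) + ∑ (segmentations v) (λ s → 1 * leadingPair K s)
        ≡⟨ ∑-+ (segmentations v) _ _ ⟨
      ∑ (segmentations v) (λ s → 𝟙 (null v) * G (appendPairCycle s) + 1 * leadingPair K s)
        ≡⟨ ∑-congᴬ (segmentations v) (segmentations-sound v) (leading v) ⟩
      ∑ (segmentations v) (λ s → ∑ (extend x s) (λ s → 1 * f (insertPairInCycles 1 s) + 𝟙 (null v) * f (appendPairCycle s)))
        ≡⟨ ∑-segmentations-∷ x v _ ⟨
      ∑ (segmentations (x ∷ v)) (λ s → 1 * f (insertPairInCycles 1 s) + 𝟙 (null v) * f (appendPairCycle s)) ∎
    regroup (y ∷ u′) =
      trans (+-identityʳ _)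
        (trans (∑-congᴬ (segmentations ((y ∷ u′) ++ v)) (segmentations-sound ((y ∷ u′) ++ v)) (inner y u′))
               (sym (∑-segmentations-∷ x ((y ∷ u′) ++ v) _)))

IsWord : ℕ → ℕ → List ℕ → Set
IsWord l m w = length w ≡ l × All (λ x → 1 ≤ x × x ≤ m) w

words-sound : ∀ l m → All (IsWord l m) (words l m)
words-sound zero    m = (refl , []) ∷ []
words-sound (suc l) m = concat⁺ (map⁺ (All.map (λ {x} x∈ → map⁺ (All.map (λ (|w| , w∈) → cong suc |w| , x∈ ∷ w∈) (words-sound l m)))
                                                (range1-bounded m)))

∑-words-suc : ∀ l m (f : List ℕ → ℕ) → ∑ (words (suc l) m) f ≡ ∑ (range1 m) (λ x → ∑ (words l m) (λ w → f (x ∷ w)))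
∑-words-suc l m f = trans (∑-concatMap (λ x → map (x ∷_) (words l m)) (range1 m) f)
                          (∑-cong (range1 m) (λ x → ∑-map (x ∷_) (words l m) f))

∑-range1-suc : ∀ m (f : ℕ → ℕ) → ∑ (range1 (suc m)) f ≡ ∑ (range1 m) f + (f (suc m) + 0)
∑-range1-suc m f = trans (cong (λ L → ∑ L f) (range1-suc m)) (∑-++ (range1 m) (suc m ∷ []) f)

≤⇒≡ᵇsuc-false : ∀ {x m} → x ≤ m → (x ≡ᵇ suc m) ≡ false
≤⇒≡ᵇsuc-false {x} {m} x≤m = ≢⇒≡ᵇ-false {x} {suc m} (λ { refl → 1+n≰n x≤m })

range1-≢suc : ∀ m → All (λ x → (x ≡ᵇ suc m) ≡ false) (range1 m)
range1-≢suc m = All.map (≤⇒≡ᵇsuc-false ∘ proj₂) (range1-bounded m)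

-- Words over [1..n+1] in which n+1 occurs exactly twice, adjacently, are the words over [1..n]
-- with the pair inserted at one of their positions.

module Words (n : ℕ) where
  open Pair (suc n)

  ∑-words-noN : ∀ K (g : List ℕ → ℕ) → ∑ (words K (suc n)) (λ w → 𝟙 (noN w) * g w) ≡ ∑ (words K n) g
  ∑-words-noN zero    g = cong (_+ 0) (+-identityʳ (g []))
  ∑-words-noN (suc K) g = begin
    ∑ (words (suc K) (suc n)) (λ w → 𝟙 (noN w) * g w)
      ≡⟨ ∑-words-suc K (suc n) _ ⟩
    ∑ (range1 (suc n)) (λ x → ∑ (words K (suc n)) (λ w → 𝟙 (noN (x ∷ w)) * g (x ∷ w)))
      ≡⟨ ∑-range1-suc n _ ⟩
    ∑ (range1 n) (λ x → ∑ (words K (suc n)) (λ w → 𝟙 (noN (x ∷ w)) * g (x ∷ w)))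
      + (∑ (words K (suc n)) (λ w → 𝟙 (noN (suc n ∷ w)) * g (suc n ∷ w)) + 0)
      ≡⟨ cong₂ _+_ (∑-congᴬ (range1 n) (range1-≢suc n) (λ x x≢N →
                      trans (∑-cong (words K (suc n)) (λ w → cong (λ z → 𝟙 (not z ∧ noN w) * g (x ∷ w)) x≢N))
                            (∑-words-noN K (λ w → g (x ∷ w)))))
                   (cong (_+ 0) (∑-zero (words K (suc n)) (λ w → cong (λ z → 𝟙 (not z ∧ noN w) * g (suc n ∷ w)) (≡ᵇ-refl (suc n))))) ⟩
    ∑ (range1 n) (λ x → ∑ (words K n) (λ w → g (x ∷ w))) + 0
      ≡⟨ +-identityʳ _ ⟩
    ∑ (range1 n) (λ x → ∑ (words K n) (λ w → g (x ∷ w)))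
      ≡⟨ ∑-words-suc K n g ⟨
    ∑ (words (suc K) n) g ∎

  ∑-words-pairFirst : ∀ K (g : List ℕ → ℕ) →
    ∑ (words (suc K) (suc n)) (λ w → 𝟙 (onePair (suc n ∷ w)) * g (suc n ∷ w)) ≡ ∑ (words K n) (λ v → g (suc n ∷ suc n ∷ v))
  ∑-words-pairFirst K g = begin
    ∑ (words (suc K) (suc n)) (λ w → 𝟙 (onePair (suc n ∷ w)) * g (suc n ∷ w))
      ≡⟨ ∑-cong (words (suc K) (suc n)) (λ w → cong (λ z → 𝟙 (if z then pairThenNoN w else onePair w) * g (suc n ∷ w)) (≡ᵇ-refl (suc n))) ⟩
    ∑ (words (suc K) (suc n)) (λ w → 𝟙 (pairThenNoN w) * g (suc n ∷ w))
      ≡⟨ ∑-words-suc K (suc n) _ ⟩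
    ∑ (range1 (suc n)) (λ y → ∑ (words K (suc n)) (λ v → 𝟙 (pairThenNoN (y ∷ v)) * g (suc n ∷ y ∷ v)))
      ≡⟨ ∑-range1-suc n _ ⟩
    ∑ (range1 n) (λ y → ∑ (words K (suc n)) (λ v → 𝟙 (pairThenNoN (y ∷ v)) * g (suc n ∷ y ∷ v)))
      + (∑ (words K (suc n)) (λ v → 𝟙 (pairThenNoN (suc n ∷ v)) * g (suc n ∷ suc n ∷ v)) + 0)
      ≡⟨ cong₂ _+_ (∑-zeroᴬ (range1 n) (range1-≢suc n) (λ y y≢N →
                      ∑-zero (words K (suc n)) (λ v → cong (λ z → 𝟙 (z ∧ noN v) * g (suc n ∷ y ∷ v)) y≢N)))
                   (cong (_+ 0) (∑-cong (words K (suc n)) (λ v → cong (λ z → 𝟙 (z ∧ noN v) * g (suc n ∷ suc n ∷ v)) (≡ᵇ-refl (suc n))))) ⟩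
    0 + (∑ (words K (suc n)) (λ v → 𝟙 (noN v) * g (suc n ∷ suc n ∷ v)) + 0)
      ≡⟨ trans (+-identityʳ _) (∑-words-noN K (λ v → g (suc n ∷ suc n ∷ v))) ⟩
    ∑ (words K n) (λ v → g (suc n ∷ suc n ∷ v)) ∎

  ∑-words-onePair : ∀ K (g : List ℕ → ℕ) →
    ∑ (words (suc (suc K)) (suc n)) (λ w → 𝟙 (onePair w) * g w) ≡ ∑ (words K n) (λ w → ∑< (suc K) (λ i → g (insertPair i w)))
  ∑-words-onePair K g = begin
    ∑ (words (suc (suc K)) (suc n)) (λ w → 𝟙 (onePair w) * g w)
      ≡⟨ ∑-words-suc (suc K) (suc n) _ ⟩
    ∑ (range1 (suc n)) (λ x → ∑ (words (suc K) (suc n)) (λ w → 𝟙 (onePair (x ∷ w)) * g (x ∷ w)))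
      ≡⟨ ∑-range1-suc n _ ⟩
    ∑ (range1 n) (λ x → ∑ (words (suc K) (suc n)) (λ w → 𝟙 (onePair (x ∷ w)) * g (x ∷ w)))
      + (∑ (words (suc K) (suc n)) (λ w → 𝟙 (onePair (suc n ∷ w)) * g (suc n ∷ w)) + 0)
      ≡⟨ cong₂ _+_ (∑-congᴬ (range1 n) (range1-≢suc n) (λ x x≢N →
                      ∑-cong (words (suc K) (suc n)) (λ w → cong (λ z → 𝟙 (if z then pairThenNoN w else onePair w) * g (x ∷ w)) x≢N)))
                   (cong (_+ 0) (∑-words-pairFirst K g)) ⟩
    ∑ (range1 n) (λ x → ∑ (words (suc K) (suc n)) (λ w → 𝟙 (onePair w) * g (x ∷ w)))
      + (∑ (words K n) (λ v → g (suc n ∷ suc n ∷ v)) + 0)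
      ≡⟨ byFirstLetter K ⟩
    ∑ (words K n) (λ w → ∑< (suc K) (λ i → g (insertPair i w))) ∎
    where
    byFirstLetter : ∀ K →
      ∑ (range1 n) (λ x → ∑ (words (suc K) (suc n)) (λ w → 𝟙 (onePair w) * g (x ∷ w))) + (∑ (words K n) (λ v → g (suc n ∷ suc n ∷ v)) + 0)
      ≡ ∑ (words K n) (λ w → ∑< (suc K) (λ i → g (insertPair i w)))
    byFirstLetter zero = cong (_+ (g (suc n ∷ suc n ∷ []) + 0 + 0))
      (∑-zero (range1 n) (λ x → trans (∑-words-suc 0 (suc n) _)
        (∑-zero (range1 (suc n)) (λ y → cong (λ z → 𝟙 z * g (x ∷ y ∷ []) + 0) (onePair-singleton y)))))
      where
      onePair-singleton : ∀ y → onePair (y ∷ []) ≡ false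
      onePair-singleton y with y ≡ᵇ suc n
      ... | true  = refl
      ... | false = refl
    byFirstLetter (suc K) = begin
      ∑ (range1 n) (λ x → ∑ (words (suc (suc K)) (suc n)) (λ w → 𝟙 (onePair w) * g (x ∷ w)))
        + (∑ (words (suc K) n) (λ v → g (suc n ∷ suc n ∷ v)) + 0)
        ≡⟨ cong₂ _+_ (∑-cong (range1 n) (λ x → ∑-words-onePair K (λ w → g (x ∷ w)))) (cong (_+ 0) (∑-words-suc K n _)) ⟩
      ∑ (range1 n) (λ x → ∑ (words K n) (λ w → ∑< (suc K) (λ i → g (x ∷ insertPair i w))))
        + (∑ (range1 n) (λ x → ∑ (words K n) (λ w → g (suc n ∷ suc n ∷ x ∷ w))) + 0)
        ≡⟨ lemma A B ⟩
      ∑ (range1 n) (λ x → ∑ (words K n) (λ w → g (suc n ∷ suc n ∷ x ∷ w)))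
        + ∑ (range1 n) (λ x → ∑ (words K n) (λ w → ∑< (suc K) (λ i → g (x ∷ insertPair i w))))
        ≡⟨ ∑-+ (range1 n) _ _ ⟨
      ∑ (range1 n) (λ x → ∑ (words K n) (λ w → g (suc n ∷ suc n ∷ x ∷ w)) + ∑ (words K n) (λ w → ∑< (suc K) (λ i → g (x ∷ insertPair i w))))
        ≡⟨ ∑-cong (range1 n) (λ x → sym (∑-+ (words K n) _ _)) ⟩
      ∑ (range1 n) (λ x → ∑ (words K n) (λ w → ∑< (suc (suc K)) (λ i → g (insertPair i (x ∷ w)))))
        ≡⟨ ∑-words-suc K n _ ⟨
      ∑ (words (suc K) n) (λ w → ∑< (suc (suc K)) (λ i → g (insertPair i w))) ∎
      where
      A B : ℕ
      A = ∑ (range1 n) (λ x → ∑ (words K n) (λ w → ∑< (suc K) (λ i → g (x ∷ insertPair i w))))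
      B = ∑ (range1 n) (λ x → ∑ (words K n) (λ w → g (suc n ∷ suc n ∷ x ∷ w)))
      lemma : ∀ a b → a + (b + 0) ≡ b + a
      lemma = solve-∀

-- Inserting the pair (n+1) (n+1) into a Stirling permutation of the second kind of order n,
-- inside a cycle after its first entry or as a new last cycle, gives one of order n+1.

module Insertion (n : ℕ) where
  open Pair (suc n)

  InRange : ℕ → Set
  InRange x = 1 ≤ x × x ≤ n

  InRange⇒≢N : ∀ {x} → InRange x → (x ≡ᵇ suc n) ≡ false
  InRange⇒≢N = ≤⇒≡ᵇsuc-false ∘ proj₂

  length-insertPair : ∀ k w → length (insertPair k w) ≡ suc (suc (length w))
  length-insertPair zero    w       = refl
  length-insertPair (suc k) []      = refl
  length-insertPair (suc k) (x ∷ w) = cong suc (length-insertPair k w)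

  count-insertPair : ∀ i k w → count i (insertPair k w) ≡ 2 * 𝟙 (i ≡ᵇ suc n) + count i w
  count-insertPair i zero    w rewrite count-cons i (suc n) (suc n ∷ w) | count-cons i (suc n) w with i ≡ᵇ suc n
  ... | true  = refl
  ... | false = refl
  count-insertPair i (suc k) [] rewrite count-cons i (suc n) (suc n ∷ []) | count-cons i (suc n) [] with i ≡ᵇ suc n
  ... | true  = refl
  ... | false = refl
  count-insertPair i (suc k) (x ∷ w) rewrite count-cons i x (insertPair k w) | count-cons i x w | count-insertPair i k w =
    lemma (𝟙 (i ≡ᵇ x)) (2 * 𝟙 (i ≡ᵇ suc n)) (count i w)
    where
    lemma : ∀ a b c → a + (b + c) ≡ b + (a + c)
    lemma = solve-∀

  all-insertPair : ∀ (p : ℕ → Bool) k w → all p (insertPair k w) ≡ p (suc n) ∧ (p (suc n) ∧ all p w)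
  all-insertPair p zero    w       = refl
  all-insertPair p (suc k) []      = refl
  all-insertPair p (suc k) (x ∷ w) rewrite all-insertPair p k w with p x | p (suc n)
  ... | true  | _     = refl
  ... | false | true  = refl
  ... | false | false = refl

  count-N≡0 : ∀ {w} → All InRange w → count (suc n) w ≡ 0
  count-N≡0 {[]}    []         = refl
  count-N≡0 {x ∷ w} (x∈ ∷ w∈) rewrite count-cons (suc n) x w | ≡ᵇ-sym (suc n) x | InRange⇒≢N x∈ = count-N≡0 w∈

  count-insertPair-N : ∀ k {w} → All InRange w → count (suc n) (insertPair k w) ≡ 2
  count-insertPair-N k {w} w∈ = trans (count-insertPair (suc n) k w) (cong₂ (λ b c → 2 * 𝟙 b + c) (≡ᵇ-refl (suc n)) (count-N≡0 w∈))

  count-insertPair-InRange : ∀ k w {i} → InRange i → count i (insertPair k w) ≡ count i w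
  count-insertPair-InRange k w {i} i∈ = trans (count-insertPair i k w) (cong (λ b → 2 * 𝟙 b + count i w) (InRange⇒≢N i∈))

  isPerm-insertPair : ∀ k w → All InRange w → isPermOf[ suc n ]₂ (insertPair k w) ≡ isPermOf[ n ]₂ w
  isPerm-insertPair k w w∈ = cong₂ _∧_ sameLength (cong₂ _∧_ sameRange sameCounts)
    where
    sameLength : (length (insertPair k w) ≡ᵇ 2 * suc n) ≡ (length w ≡ᵇ 2 * n)
    sameLength = cong₂ _≡ᵇ_ (length-insertPair k w) (*-suc 2 n)
    inRange : ∀ m → n ≤ m → all (λ x → (1 ≤ᵇ x) ∧ (x ≤ᵇ m)) w ≡ true
    inRange m n≤m = all-true _ w (All.map (λ {x} (1≤x , x≤n) → trans (cong (_∧ (x ≤ᵇ m)) (≤⇒≤ᵇ-true 1≤x)) (≤⇒≤ᵇ-true (≤-trans x≤n n≤m))) w∈)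
    sameRange : all (λ x → (1 ≤ᵇ x) ∧ (x ≤ᵇ suc n)) (insertPair k w) ≡ all (λ x → (1 ≤ᵇ x) ∧ (x ≤ᵇ n)) w
    sameRange rewrite all-insertPair (λ x → (1 ≤ᵇ x) ∧ (x ≤ᵇ suc n)) k w | inRange (suc n) (n≤1+n n) | inRange n ≤-refl
                    | ≤⇒≤ᵇ-true (≤-refl {suc n}) = refl
    twice : ℕ → Bool
    twice i = count i (insertPair k w) ≡ᵇ 2
    sameCounts : all twice (range1 (suc n)) ≡ all (λ i → count i w ≡ᵇ 2) (range1 n)
    sameCounts = begin
      all twice (range1 (suc n))                          ≡⟨ cong (all twice) (range1-suc n) ⟩
      all twice (range1 n ++ suc n ∷ [])                  ≡⟨ all-++ twice (range1 n) (suc n ∷ []) ⟩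
      all twice (range1 n) ∧ (twice (suc n) ∧ true)       ≡⟨ cong₂ _∧_ (all-cong twice _ (range1 n) (All.map (cong (_≡ᵇ 2) ∘ count-insertPair-InRange k w) (range1-bounded n)))
                                                                     (cong (λ c → (c ≡ᵇ 2) ∧ true) (count-insertPair-N k w∈)) ⟩
      all (λ i → count i w ≡ᵇ 2) (range1 n) ∧ true       ≡⟨ ∧-identityʳ _ ⟩
      all (λ i → count i w ≡ᵇ 2) (range1 n)               ∎

  insertPair-++ : ∀ k u v → insertPair k (u ++ v) ≡ (if k ≤ᵇ length u then insertPair k u ++ v else u ++ insertPair (k ∸ length u) v)
  insertPair-++ zero    u       v = refl
  insertPair-++ (suc k) []      v = refl
  insertPair-++ (suc k) (x ∷ u) v rewrite ≤ᵇ-suc k (length u) | insertPair-++ k u v with k ≤ᵇ length u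
  ... | true  = refl
  ... | false = refl

  concat-insertPairInCycles : ∀ k s → concat (insertPairInCycles k s) ≡ insertPair k (concat s)
  concat-insertPairInCycles zero    []       = refl
  concat-insertPairInCycles (suc k) []       = refl
  concat-insertPairInCycles k       (b ∷ bs) with k ≤ᵇ length b | insertPair-++ k b (concat bs)
  ... | true  | e = sym e
  ... | false | e = trans (cong (b ++_) (concat-insertPairInCycles (k ∸ length b) bs)) (sym e)

  nonempty-insertPairInCycles : ∀ k s → nonempty (insertPairInCycles k s) ≡ true
  nonempty-insertPairInCycles k []       = refl
  nonempty-insertPairInCycles k (b ∷ bs) with k ≤ᵇ length b
  ... | true  = refl
  ... | false = refl

  paired-insertPair : ∀ k b → All InRange b → paired (insertPair k b) ≡ paired b
  paired-insertPair k b b∈ = begin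
    all twice (insertPair k b)                   ≡⟨ all-insertPair twice k b ⟩
    twice (suc n) ∧ (twice (suc n) ∧ all twice b) ≡⟨ cong (λ z → z ∧ (z ∧ all twice b)) (cong (_≡ᵇ 2) (count-insertPair-N k b∈)) ⟩
    all twice b                                  ≡⟨ all-cong twice _ b (All.map (cong (_≡ᵇ 2) ∘ count-insertPair-InRange k b) b∈) ⟩
    paired b                                     ∎
    where
    twice : ℕ → Bool
    twice x = count x (insertPair k b) ≡ᵇ 2

  copiesTogether-insertPairInCycles : ∀ k s → All (All InRange) s → copiesTogether (insertPairInCycles k s) ≡ copiesTogether s
  copiesTogether-insertPairInCycles k []       []          = cong (_∧ true) (paired-insertPair 0 [] [])
  copiesTogether-insertPairInCycles k (b ∷ bs) (b∈ ∷ bs∈) with k ≤ᵇ length b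
  ... | true  = cong (_∧ copiesTogether bs) (paired-insertPair k b b∈)
  ... | false = cong (paired b ∧_) (copiesTogether-insertPairInCycles (k ∸ length b) bs bs∈)

  copiesTogether-appendPairCycle : ∀ s → copiesTogether (appendPairCycle s) ≡ copiesTogether s
  copiesTogether-appendPairCycle []       = cong (_∧ true) (paired-insertPair 0 [] [])
  copiesTogether-appendPairCycle (b ∷ bs) = cong (paired b ∧_) (copiesTogether-appendPairCycle bs)

  ∈ᵇ-insertPair : ∀ x k v → (x ≡ᵇ suc n) ≡ false → (x ∈ᵇ insertPair k v) ≡ (x ∈ᵇ v)
  ∈ᵇ-insertPair x zero    v       x≢N rewrite x≢N = refl
  ∈ᵇ-insertPair x (suc k) []      x≢N rewrite x≢N = refl
  ∈ᵇ-insertPair x (suc k) (y ∷ v) x≢N = cong ((x ≡ᵇ y) ∨_) (∈ᵇ-insertPair x k v x≢N)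

  prefix-insertPair : ∀ x k v → (x <ᵇ suc n) ≡ true → (x ≡ᵇ suc n) ≡ false →
    all (x <ᵇ_) (takeWhileᵇ (λ y → not (y ≡ᵇ x)) (insertPair k v)) ≡ all (x <ᵇ_) (takeWhileᵇ (λ y → not (y ≡ᵇ x)) v)
  -- one rewrite for each copy of n+1
  prefix-insertPair x zero    v       x<N x≢N rewrite trans (≡ᵇ-sym (suc n) x) x≢N | trans (≡ᵇ-sym (suc n) x) x≢N | x<N = refl
  prefix-insertPair x (suc k) []      x<N x≢N rewrite trans (≡ᵇ-sym (suc n) x) x≢N | trans (≡ᵇ-sym (suc n) x) x≢N | x<N = refl
  prefix-insertPair x (suc k) (y ∷ v) x<N x≢N with y ≡ᵇ x
  ... | true  = refl
  ... | false = cong ((x <ᵇ y) ∧_) (prefix-insertPair x k v x<N x≢N)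

  N-∉ᵇ : ∀ {v} → All InRange v → (suc n ∈ᵇ v) ≡ false
  N-∉ᵇ {[]}    []         = refl
  N-∉ᵇ {x ∷ v} (x∈ ∷ v∈) rewrite ≡ᵇ-sym (suc n) x | InRange⇒≢N x∈ = N-∉ᵇ v∈

  betweenGreater-insertPair : ∀ k {v} → All InRange v → betweenGreater (insertPair k v) ≡ betweenGreater v
  betweenGreater-insertPair zero    {v}     v∈ rewrite ≡ᵇ-refl (suc n) | N-∉ᵇ v∈ = refl
  betweenGreater-insertPair (suc k) {[]}    []        rewrite ≡ᵇ-refl (suc n) = refl
  betweenGreater-insertPair (suc k) {x ∷ v} (x∈ ∷ v∈) = cong₂ _∧_
    (cong₂ (λ a b → if a then b else true) (∈ᵇ-insertPair x k v (InRange⇒≢N x∈))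
                                          (prefix-insertPair x k v (<⇒<ᵇ-true (s≤s (proj₂ x∈))) (InRange⇒≢N x∈)))
    (betweenGreater-insertPair k v∈)

  isCycle-pair : isCycle (suc n ∷ suc n ∷ []) ≡ true
  isCycle-pair rewrite ≤⇒≤ᵇ-true (≤-refl {suc n}) = betweenGreater-insertPair 0 []

  isCycle-insertPair : ∀ j c b → All InRange (c ∷ b) → isCycle (insertPair (suc j) (c ∷ b)) ≡ isCycle (c ∷ b)
  isCycle-insertPair j c b (c∈ ∷ b∈) = cong₂ _∧_ minFirst (betweenGreater-insertPair (suc j) (c∈ ∷ b∈))
    where
    minFirst : all (c ≤ᵇ_) (c ∷ insertPair j b) ≡ all (c ≤ᵇ_) (c ∷ b)
    minFirst rewrite all-insertPair (c ≤ᵇ_) j b | ≤⇒≤ᵇ-true (≤-trans (proj₂ c∈) (n≤1+n n)) = refl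

  ≰ᵇ⇒< : ∀ {k m} → (k ≤ᵇ m) ≡ false → m < k
  ≰ᵇ⇒< {k} {m} e = ≰⇒> (λ k≤m → case (trans (sym (≤⇒≤ᵇ-true k≤m)) e))
    where
    case : true ≡ false → _
    case ()

  all-isCycle-insertPairInCycles : ∀ k s → 1 ≤ k → Nonempty s → All (All InRange) s →
    all isCycle (insertPairInCycles k s) ≡ all isCycle s
  all-isCycle-insertPairInCycles k       []             _   []          []         = cong (_∧ true) isCycle-pair
  all-isCycle-insertPairInCycles k       ((c ∷ b) ∷ bs) 1≤k (_ ∷ bs≢[]) (b∈ ∷ bs∈) with k ≤ᵇ length (c ∷ b) in k≤b
  all-isCycle-insertPairInCycles (suc j) ((c ∷ b) ∷ bs) _   _           (b∈ ∷ _)   | true  = cong (_∧ all isCycle bs) (isCycle-insertPair j c b b∈)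
  ... | false = cong (isCycle (c ∷ b) ∧_) (all-isCycle-insertPairInCycles (k ∸ length (c ∷ b)) bs (m<n⇒0<n∸m {length (c ∷ b)} {k} (≰ᵇ⇒< k≤b)) bs≢[] bs∈)

  all-isCycle-appendPairCycle : ∀ s → all isCycle (appendPairCycle s) ≡ all isCycle s
  all-isCycle-appendPairCycle []       = cong (_∧ true) isCycle-pair
  all-isCycle-appendPairCycle (b ∷ bs) = cong (isCycle b ∧_) (all-isCycle-appendPairCycle bs)

  increasing : List ℕ → Bool
  increasing []          = true
  increasing (x ∷ [])    = true
  increasing (x ∷ y ∷ r) = (x <ᵇ y) ∧ increasing (y ∷ r)

  increasingFirsts≡ : ∀ s → increasingFirsts s ≡ increasing (map first s)
  increasingFirsts≡ []          = refl
  increasingFirsts≡ (c ∷ [])    = refl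
  increasingFirsts≡ (c ∷ d ∷ r) = cong ((first c <ᵇ first d) ∧_) (increasingFirsts≡ (d ∷ r))

  firsts-insertPairInCycles : ∀ k s → 1 ≤ k → k ≤ length (concat s) → Nonempty s → map first (insertPairInCycles k s) ≡ map first s
  firsts-insertPairInCycles (suc k) []             _   ()  _
  firsts-insertPairInCycles k       ((c ∷ b) ∷ bs) 1≤k k≤ (_ ∷ bs≢[]) with k ≤ᵇ length (c ∷ b) in k≤b
  firsts-insertPairInCycles (suc j) ((c ∷ b) ∷ bs) _   _  _           | true  = refl
  ... | false = cong (c ∷_) (firsts-insertPairInCycles (k ∸ length (c ∷ b)) bs (m<n⇒0<n∸m {length (c ∷ b)} {k} (≰ᵇ⇒< k≤b)) k∸b≤ bs≢[])
    where
    k∸b≤ : k ∸ length (c ∷ b) ≤ length (concat bs)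
    k∸b≤ = subst (k ∸ length (c ∷ b) ≤_) (m+n∸m≡n (length (c ∷ b)) (length (concat bs)))
                 (∸-monoˡ-≤ (length (c ∷ b)) (subst (k ≤_) (length-++ (c ∷ b)) k≤))

  increasingFirsts-insertPairInCycles : ∀ k s → 1 ≤ k → k ≤ length (concat s) → Nonempty s →
    increasingFirsts (insertPairInCycles k s) ≡ increasingFirsts s
  increasingFirsts-insertPairInCycles k s 1≤k k≤ s≢[] =
    trans (increasingFirsts≡ (insertPairInCycles k s))
          (trans (cong increasing (firsts-insertPairInCycles k s 1≤k k≤ s≢[])) (sym (increasingFirsts≡ s)))

  increasingFirsts-appendPairCycle : ∀ s → Nonempty s → All (All InRange) s →
    increasingFirsts (appendPairCycle s) ≡ increasingFirsts s
  increasingFirsts-appendPairCycle s s≢[] s∈ = begin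
    increasingFirsts (appendPairCycle s)               ≡⟨ increasingFirsts≡ (appendPairCycle s) ⟩
    increasing (map first (s ++ (suc n ∷ suc n ∷ []) ∷ [])) ≡⟨ cong increasing (map-++ first s _) ⟩
    increasing (map first s ++ suc n ∷ [])             ≡⟨ increasing-snoc (map first s) (firsts< s s≢[] s∈) ⟩
    increasing (map first s)                           ≡⟨ increasingFirsts≡ s ⟨
    increasingFirsts s                                 ∎
    where
    increasing-snoc : ∀ L → All (_< suc n) L → increasing (L ++ suc n ∷ []) ≡ increasing L
    increasing-snoc []          _         = refl
    increasing-snoc (x ∷ [])    (x<N ∷ _) rewrite <⇒<ᵇ-true x<N = refl
    increasing-snoc (x ∷ y ∷ r) (_ ∷ r<N) = cong ((x <ᵇ y) ∧_) (increasing-snoc (y ∷ r) r<N)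
    firsts< : ∀ s → Nonempty s → All (All InRange) s → All (_< suc n) (map first s)
    firsts< []             []          []                 = []
    firsts< ((c ∷ b) ∷ bs) (_ ∷ bs≢[]) ((c∈ ∷ _) ∷ bs∈) = s≤s (proj₂ c∈) ∷ firsts< bs bs≢[] bs∈

  isStirling2′-insertPairInCycles : ∀ k s → 1 ≤ k → k ≤ length (concat s) → Nonempty s → All InRange (concat s) →
    nonempty s ≡ true → isStirling2′ (suc n) (insertPairInCycles k s) ≡ isStirling2′ n s
  isStirling2′-insertPairInCycles k s 1≤k k≤ s≢[] s∈ s≠[] =
    cong₂ _∧_ (trans (nonempty-insertPairInCycles k s) (sym s≠[]))
   (cong₂ _∧_ (trans (cong isPermOf[ suc n ]₂ (concat-insertPairInCycles k s)) (isPerm-insertPair k (concat s) s∈))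
   (cong₂ _∧_ (copiesTogether-insertPairInCycles k s (concat⁻ s∈))
   (cong₂ _∧_ (all-isCycle-insertPairInCycles k s 1≤k s≢[] (concat⁻ s∈))
              (increasingFirsts-insertPairInCycles k s 1≤k k≤ s≢[]))))

  isStirling2′-appendPairCycle : ∀ s → Nonempty s → All InRange (concat s) → nonempty s ≡ true →
    isStirling2′ (suc n) (appendPairCycle s) ≡ isStirling2′ n s
  isStirling2′-appendPairCycle s s≢[] s∈ s≠[] =
    cong₂ _∧_ (trans (nonempty-++ s) (sym s≠[]))
   (cong₂ _∧_ (trans (cong isPermOf[ suc n ]₂ concat-append) (isPerm-insertPair (length (concat s)) (concat s) s∈))
   (cong₂ _∧_ (copiesTogether-appendPairCycle s)
   (cong₂ _∧_ (all-isCycle-appendPairCycle s)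
              (increasingFirsts-appendPairCycle s s≢[] (concat⁻ s∈)))))
    where
    nonempty-++ : ∀ s → nonempty (appendPairCycle s) ≡ true
    nonempty-++ []      = refl
    nonempty-++ (_ ∷ _) = refl
    insertPair-end : ∀ w → insertPair (length w) w ≡ w ++ suc n ∷ suc n ∷ []
    insertPair-end []      = refl
    insertPair-end (x ∷ w) = cong (x ∷_) (insertPair-end w)
    concat-append : concat (appendPairCycle s) ≡ insertPair (length (concat s)) (concat s)
    concat-append = trans (sym (concat-++ s _)) (sym (insertPair-end (concat s)))

-- In a Stirling permutation of the second kind whose largest entry N occurs twice, the pair N N
-- is admissible: N is maximal, so nothing fits between its copies, and a cycle starting with N is (N N).

module Placement (N : ℕ) where
  open Pair N

  noN⇒count≡0 : ∀ b → noN b ≡ true → count N b ≡ 0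
  noN⇒count≡0 []      _ = refl
  noN⇒count≡0 (y ∷ b) e with y ≡ᵇ N in y≡N
  ... | false rewrite count-cons N y b | ≡ᵇ-sym N y | y≡N = noN⇒count≡0 b e

  count≡0⇒noN : ∀ b → count N b ≡ 0 → noN b ≡ true
  count≡0⇒noN []      _ = refl
  count≡0⇒noN (y ∷ b) e rewrite count-cons N y b | ≡ᵇ-sym N y with y ≡ᵇ N
  ... | false = count≡0⇒noN b e

  count≡1⇒∈ᵇ : ∀ b → count N b ≡ 1 → (N ∈ᵇ b) ≡ true
  count≡1⇒∈ᵇ b e with N ∈ᵇ b in N∈b
  ... | true  = refl
  ... | false = contradiction (trans (sym (count-∉ N b N∈b)) e) 0≢1+n

  ¬noN⇒∈ᵇ : ∀ b → noN b ≡ false → (N ∈ᵇ b) ≡ true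
  ¬noN⇒∈ᵇ (y ∷ b) e with y ≡ᵇ N in y≡N
  ... | true  rewrite ≡ᵇ-sym N y | y≡N = refl
  ... | false rewrite ≡ᵇ-sym N y | y≡N = ¬noN⇒∈ᵇ b e

  count-∷-≢ : ∀ y r → (y ≡ᵇ N) ≡ false → count N (y ∷ r) ≡ count N r
  count-∷-≢ y r y≢N = trans (count-cons N y r) (cong (λ b → 𝟙 b + count N r) (trans (≡ᵇ-sym N y) y≢N))

  count-∷-N : ∀ r → count N (N ∷ r) ≡ suc (count N r)
  count-∷-N r = trans (count-cons N N r) (cong (λ b → 𝟙 b + count N r) (≡ᵇ-refl N))

  betweenGreater⇒onePair : ∀ r → betweenGreater r ≡ true → count N r ≡ 2 → All (_≤ N) r → onePair r ≡ true
  betweenGreater⇒onePair []      _  ()  _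
  betweenGreater⇒onePair (y ∷ r) bg two (y≤N ∷ r≤N) with y ≡ᵇ N in y≡N
  ... | false = betweenGreater⇒onePair r (proj₂ (∧-true⇒ {b = betweenGreater r} bg)) (trans (sym (count-∷-≢ y r y≡N)) two) r≤N
  ... | true with ≡ᵇ-true⇒≡ {y} {N} y≡N
  ...   | refl = next r (suc-injective (trans (sym (count-∷-N r)) two)) (proj₁ (∧-true⇒ {b = betweenGreater r} bg)) r≤N
    where
    next : ∀ r → count N r ≡ 1 → (if N ∈ᵇ r then all (N <ᵇ_) (takeWhileᵇ (λ z → not (z ≡ᵇ N)) r) else true) ≡ true →
           All (_≤ N) r → pairThenNoN r ≡ true
    next []      () _ _
    next (z ∷ q) one between (z≤N ∷ _) with z ≡ᵇ N in z≡N
    ... | true with ≡ᵇ-true⇒≡ {z} {N} z≡N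
    ...   | refl = count≡0⇒noN q (suc-injective (trans (sym (count-∷-N q)) one))
    next (z ∷ q) one between (z≤N ∷ _) | false rewrite count≡1⇒∈ᵇ (z ∷ q) one = contradiction z≤N (<⇒≱ (<ᵇ-true⇒< (proj₁ (∧-true⇒ between))))

  cycle-shape : ∀ b → isCycle b ≡ true → count N b ≡ 2 → All (_≤ N) b → isPairCycle b ≡ true ⊎ pairInside b ≡ true
  cycle-shape (x ∷ r) cyc two (x≤N ∷ r≤N) with x ≡ᵇ N in x≡N
  ... | false = inj₂ (betweenGreater⇒onePair r (proj₂ (∧-true⇒ {b = betweenGreater r} (proj₂ (∧-true⇒ {all (x ≤ᵇ_) (x ∷ r)} cyc))))
                                              (trans (sym (count-∷-≢ x r x≡N)) two) r≤N)
  ... | true with ≡ᵇ-true⇒≡ {x} {N} x≡N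
  ...   | refl = inj₁ (single r (proj₂ (∧-true⇒ {b = all (N ≤ᵇ_) r} (proj₁ (∧-true⇒ {all (N ≤ᵇ_) (N ∷ r)} cyc))))
                                r≤N (suc-injective (trans (sym (count-∷-N r)) two)))
    where
    all-N : ∀ r → all (N ≤ᵇ_) r ≡ true → All (_≤ N) r → count N r ≡ length r
    all-N []      _  _           = refl
    all-N (y ∷ r) ge (y≤N ∷ r≤N) rewrite count-cons N y r | ≡⇒≡ᵇ-true (≤-antisym (≤ᵇ-true⇒≤ (proj₁ (∧-true⇒ {N ≤ᵇ y} ge))) y≤N) =
      cong suc (all-N r (proj₂ (∧-true⇒ {N ≤ᵇ y} ge)) r≤N)
    single : ∀ r → all (N ≤ᵇ_) r ≡ true → All (_≤ N) r → count N r ≡ 1 → isPairCycle (N ∷ r) ≡ true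
    single r ge r≤N one with trans (sym (all-N r ge r≤N)) one
    single (y ∷ []) ge (y≤N ∷ []) one | _
      rewrite ≡ᵇ-refl N | ≡⇒≡ᵇ-true (≤-antisym y≤N (≤ᵇ-true⇒≤ (proj₁ (∧-true⇒ {N ≤ᵇ y} ge)))) = refl

  increasingFirsts-tail : ∀ b bs → increasingFirsts (b ∷ bs) ≡ true → increasingFirsts bs ≡ true
  increasingFirsts-tail b []      _   = refl
  increasingFirsts-tail b (d ∷ r) inc = proj₂ (∧-true⇒ {first b <ᵇ first d} inc)

  pairCycle-last : ∀ b bs → isPairCycle b ≡ true → increasingFirsts (b ∷ bs) ≡ true → All (All (_≤ N)) bs → Nonempty bs → null bs ≡ true
  pairCycle-last b            []             _  _   _                 _ = refl
  pairCycle-last (a ∷ c ∷ []) ((y ∷ d) ∷ bs) pc inc ((y≤N ∷ _) ∷ _)  _ with ≡ᵇ-true⇒≡ {a} {N} (proj₁ (∧-true⇒ pc))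
  ... | refl = contradiction y≤N (<⇒≱ (<ᵇ-true⇒< (proj₁ (∧-true⇒ {N <ᵇ y} inc))))

  count-concat-∷-noN : ∀ b bs → noN b ≡ true → count N (concat (b ∷ bs)) ≡ count N (concat bs)
  count-concat-∷-noN b bs b-noN = trans (count-++ N b (concat bs)) (cong (_+ count N (concat bs)) (noN⇒count≡0 b b-noN))

  paired-¬noN : ∀ b → paired b ≡ true → noN b ≡ false → count N b ≡ 2
  paired-¬noN b p b-N = ≡ᵇ-true⇒≡ (all-true-∈ᵇ (λ x → count x b ≡ᵇ 2) b p N (¬noN⇒∈ᵇ b b-N))

  others-noN : ∀ b bs → count N b ≡ 2 → count N (concat (b ∷ bs)) ≡ 2 → all noN bs ≡ true
  others-noN b bs b-two two = trans (noN-concat bs) (count≡0⇒noN (concat bs) (+-cancelˡ-≡ 2 _ _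
    (trans (cong (_+ count N (concat bs)) (sym b-two)) (trans (sym (count-++ N b (concat bs))) two))))

  isStirling⇒admissible : ∀ s → Nonempty s → All (All (_≤ N)) s → count N (concat s) ≡ 2 →
    copiesTogether s ≡ true → all isCycle s ≡ true → increasingFirsts s ≡ true → admissible s ≡ true
  isStirling⇒admissible [] _ _ () _ _ _
  isStirling⇒admissible (b ∷ bs) (_ ∷ bs≢[]) (b≤N ∷ bs≤N) two together cycles inc with noN b in b-noN
  ... | true rewrite isStirling⇒admissible bs bs≢[] bs≤N (trans (sym (count-concat-∷-noN b bs b-noN)) two)
                       (proj₂ (∧-true⇒ {paired b} together)) (proj₂ (∧-true⇒ {isCycle b} cycles)) (increasingFirsts-tail b bs inc) =
    ∨-zeroʳ′ _
  ... | false with cycle-shape b (proj₁ (∧-true⇒ cycles)) (paired-¬noN b (proj₁ (∧-true⇒ together)) b-noN) b≤N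
  ...   | inj₂ inside rewrite inside | others-noN b bs (paired-¬noN b (proj₁ (∧-true⇒ together)) b-noN) two = ∨-zeroʳ′ _
  ...   | inj₁ pair   rewrite pair | pairCycle-last b bs pair inc bs≤N bs≢[] = refl

  onePair-noN-++ : ∀ u v → noN u ≡ true → onePair (u ++ v) ≡ onePair v
  onePair-noN-++ []      v _ = refl
  onePair-noN-++ (y ∷ u) v u-noN with y ≡ᵇ N
  ... | false = onePair-noN-++ u v u-noN

  onePair-++-noN : ∀ u v → onePair u ≡ true → noN v ≡ true → onePair (u ++ v) ≡ true
  onePair-++-noN (y ∷ u) v pu v-noN with y ≡ᵇ N
  onePair-++-noN (y ∷ z ∷ q) v pu v-noN | true with ∧-true⇒ {z ≡ᵇ N} pu
  ... | z≡N , q-noN rewrite z≡N | all-++ (λ y → not (y ≡ᵇ N)) q v | q-noN | v-noN = refl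
  onePair-++-noN (y ∷ u) v pu v-noN | false = onePair-++-noN u v pu v-noN

  admissible⇒onePair : ∀ s → admissible s ≡ true → onePair (concat s) ≡ true
  admissible⇒onePair (b ∷ bs) adm with ∨-true⇒ {isPairCycle b ∧ null bs} adm
  ... | inj₁ last = pairCycle {b} {bs} (∧-true⇒ {isPairCycle b} last)
    where
    pairCycle : ∀ {b bs} → isPairCycle b ≡ true × null bs ≡ true → onePair (concat (b ∷ bs)) ≡ true
    pairCycle {a ∷ c ∷ []} {[]} (pc , _) with ∧-true⇒ {a ≡ᵇ N} pc
    ... | a≡N , c≡N rewrite a≡N | c≡N = refl
  ... | inj₂ rest with ∨-true⇒ {noN b ∧ admissible bs} rest
  ...   | inj₁ later with ∧-true⇒ {noN b} later
  ...     | b-noN , bs-adm = trans (onePair-noN-++ b (concat bs) b-noN) (admissible⇒onePair bs bs-adm)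
  admissible⇒onePair ((x ∷ r) ∷ bs) _ | inj₂ _ | inj₂ inside with ∧-true⇒ {pairInside (x ∷ r)} inside
  ... | x-r , bs-noN with ∧-true⇒ {not (x ≡ᵇ N)} x-r
  ...   | _ , r-pair with x ≡ᵇ N
  ...     | false = onePair-++-noN r (concat bs) r-pair (trans (sym (noN-concat bs)) bs-noN)

IsCandidate : ℕ → Segmentation → Set
IsCandidate n s = Nonempty s × length (concat s) ≡ 2 * n × All (λ x → 1 ≤ x × x ≤ n) (concat s)

candidates-sound : ∀ n → All (IsCandidate n) (candidates n)
candidates-sound n = concat⁺ (map⁺ (All.map (λ { {w} (|w| , w∈) → All.map (λ { {s} (refl , s≢[]) → s≢[] , |w| , w∈ }) (segmentations-sound w) })
                                            (words-sound (2 * n) n)))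

nonempty-of-length : ∀ {n} (s : Segmentation) → 1 ≤ n → length (concat s) ≡ 2 * n → nonempty s ≡ true
nonempty-of-length []      1≤n 0≡2n = contradiction (subst (1 ≤_) (sym 0≡2n) (≤-trans 1≤n (m≤n*m _ 2))) λ ()
nonempty-of-length (_ ∷ _) _   _    = refl

isPerm⇒count-top : ∀ n v → isPermOf[ suc n ]₂ v ≡ true → count (suc n) v ≡ 2
isPerm⇒count-top n v perm with ∧-true⇒ {length v ≡ᵇ 2 * suc n} perm
... | _ , rest with ∧-true⇒ {all (λ x → (1 ≤ᵇ x) ∧ (x ≤ᵇ suc n)) v} rest
... | _ , counts = ≡ᵇ-true⇒≡ (proj₁ (∧-true⇒ {count (suc n) v ≡ᵇ 2} (proj₂ (∧-true⇒ {all twice (range1 n)}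
                     (trans (sym (all-++ twice (range1 n) (suc n ∷ []))) (trans (cong (all twice) (sym (range1-suc n))) counts))))))
  where
  twice : ℕ → Bool
  twice i = count i v ≡ᵇ 2

module Decomposition (n : ℕ) (g : Segmentation → ℕ) where
  open Pair (suc n)
  open Words n
  open Insertion n
  open Placement (suc n)

  f : Segmentation → ℕ
  f s = 𝟙 (isStirling2′ (suc n) s) * g s

  isStirling2′⇒admissible : ∀ s → Nonempty s → All (λ x → 1 ≤ x × x ≤ suc n) (concat s) →
    isStirling2′ (suc n) s ≡ true → admissible s ≡ true
  isStirling2′⇒admissible s s≢[] s∈ stirling with ∧-true⇒ {nonempty s} stirling
  ... | _ , rest with ∧-true⇒ {isPermOf[ suc n ]₂ (concat s)} rest
  ... | perm , rest with ∧-true⇒ {copiesTogether s} rest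
  ... | together , rest with ∧-true⇒ {all isCycle s} rest
  ... | cycles , inc = isStirling⇒admissible s s≢[] (All.map (All.map proj₂) (concat⁻ s∈)) (isPerm⇒count-top n (concat s) perm) together cycles inc

  f≡onePair-admissible : ∀ w s → All (λ x → 1 ≤ x × x ≤ suc n) w → IsSegmentationOf w s →
    f s ≡ 𝟙 (onePair w) * (𝟙 (admissible s) * f s)
  f≡onePair-admissible w s w∈ (refl , s≢[]) with isStirling2′ (suc n) s in stirling
  ... | false = sym (trans (cong (𝟙 (onePair (concat s)) *_) (*-zeroʳ (𝟙 (admissible s)))) (*-zeroʳ (𝟙 (onePair (concat s)))))
  ... | true rewrite isStirling2′⇒admissible s s≢[] w∈ stirling | admissible⇒onePair s (isStirling2′⇒admissible s s≢[] w∈ stirling) =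
    sym (trans (*-identityˡ _) (*-identityˡ _))

  insertPair≡take++drop : ∀ i w → insertPair i w ≡ take i w ++ suc n ∷ suc n ∷ drop i w
  insertPair≡take++drop zero    w       = refl
  insertPair≡take++drop (suc i) []      = refl
  insertPair≡take++drop (suc i) (x ∷ w) = cong (x ∷_) (insertPair≡take++drop i w)

  ∑-insertPositions : ∀ w → All InRange w →
    ∑< (suc (length w)) (λ i → ∑ (segmentations (insertPair i w)) (λ s → 𝟙 (admissible s) * f s))
    ≡ ∑ (segmentations w) (λ s → ∑< (length w) (λ i → f (insertPairInCycles (suc i) s)) + f (appendPairCycle s))
  ∑-insertPositions w w∈ = begin
    ∑< (suc (length w)) (λ i → ∑ (segmentations (insertPair i w)) (λ s → 𝟙 (admissible s) * f s))
      ≡⟨ ∑<-cong (suc (length w)) (λ i _ → atPosition i) ⟩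
    ∑< (suc (length w)) (λ i → ∑ (segmentations w) (split i))
      ≡⟨ ∑<-∑ (suc (length w)) (segmentations w) split ⟩
    ∑ (segmentations w) (λ s → ∑< (suc (length w)) (λ i → split i s))
      ≡⟨ ∑-cong (segmentations w) perSegmentation ⟩
    ∑ (segmentations w) (λ s → ∑< (length w) (λ i → f (insertPairInCycles (suc i) s)) + f (appendPairCycle s)) ∎
    where
    inCycle : ℕ → Segmentation → ℕ
    inCycle i s = 𝟙 (nonempty (take i w)) * f (insertPairInCycles (length (take i w)) s)
    atEnd : ℕ → Segmentation → ℕ
    atEnd i s = 𝟙 (null (drop i w)) * f (appendPairCycle s)
    split : ℕ → Segmentation → ℕ
    split i s = inCycle i s + atEnd i s
    atPosition : ∀ i → ∑ (segmentations (insertPair i w)) (λ s → 𝟙 (admissible s) * f s) ≡ ∑ (segmentations w) (split i)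
    atPosition i = begin
      ∑ (segmentations (insertPair i w)) (λ s → 𝟙 (admissible s) * f s)
        ≡⟨ cong (λ z → ∑ (segmentations z) (λ s → 𝟙 (admissible s) * f s)) (insertPair≡take++drop i w) ⟩
      ∑ (segmentations (take i w ++ suc n ∷ suc n ∷ drop i w)) (λ s → 𝟙 (admissible s) * f s)
        ≡⟨ ∑-admissible (take i w) (drop i w) (All.map InRange⇒≢N (take⁺ i w∈)) (All.map InRange⇒≢N (drop⁺ i w∈)) f ⟩
      ∑ (segmentations (take i w ++ drop i w)) (split i)
        ≡⟨ cong (λ z → ∑ (segmentations z) (split i)) (take++drop≡id i w) ⟩
      ∑ (segmentations w) (split i) ∎
    ∑<-inCycle : ∀ (w : List ℕ) (A : ℕ → ℕ) →
      ∑< (suc (length w)) (λ i → 𝟙 (nonempty (take i w)) * A (length (take i w))) ≡ ∑< (length w) (A ∘ suc)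
    ∑<-inCycle []      A = refl
    ∑<-inCycle (x ∷ w) A = ∑<-cong (suc (length w)) (λ i i≤|w| →
      trans (+-identityʳ _) (cong (A ∘ suc) (trans (length-take i w) (m≤n⇒m⊓n≡m (≤-pred i≤|w|)))))
    ∑<-atEnd : ∀ (w : List ℕ) B → ∑< (suc (length w)) (λ i → 𝟙 (null (drop i w)) * B) ≡ B
    ∑<-atEnd []      B = trans (+-identityʳ _) (+-identityʳ B)
    ∑<-atEnd (x ∷ w) B = ∑<-atEnd w B
    perSegmentation : ∀ s →
      ∑< (suc (length w)) (λ i → split i s) ≡ ∑< (length w) (λ i → f (insertPairInCycles (suc i) s)) + f (appendPairCycle s)
    perSegmentation s = trans (∑<-+ (suc (length w)) (λ i → inCycle i s) (λ i → atEnd i s))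
      (cong₂ _+_ (∑<-inCycle w (λ k → f (insertPairInCycles k s))) (∑<-atEnd w (f (appendPairCycle s))))

  ∑-candidates-suc : ∑ (candidates (suc n)) f
    ≡ ∑ (candidates n) (λ s → ∑< (2 * n) (λ i → f (insertPairInCycles (suc i) s)) + f (appendPairCycle s))
  ∑-candidates-suc = begin
    ∑ (concatMap segmentations (words (2 * suc n) (suc n))) f
      ≡⟨ ∑-concatMap segmentations (words (2 * suc n) (suc n)) f ⟩
    ∑ (words (2 * suc n) (suc n)) (λ w → ∑ (segmentations w) f)
      ≡⟨ cong (λ l → ∑ (words l (suc n)) (λ w → ∑ (segmentations w) f)) (*-suc 2 n) ⟩
    ∑ (words (suc (suc (2 * n))) (suc n)) (λ w → ∑ (segmentations w) f)
      ≡⟨ ∑-congᴬ (words (suc (suc (2 * n))) (suc n)) (words-sound (suc (suc (2 * n))) (suc n)) (λ w (_ , w∈) →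
           trans (∑-congᴬ (segmentations w) (segmentations-sound w) (λ s → f≡onePair-admissible w s w∈))
                 (∑-*ˡ (𝟙 (onePair w)) (segmentations w) _)) ⟩
    ∑ (words (suc (suc (2 * n))) (suc n)) (λ w → 𝟙 (onePair w) * admissibleSum w)
      ≡⟨ ∑-words-onePair (2 * n) admissibleSum ⟩
    ∑ (words (2 * n) n) (λ w → ∑< (suc (2 * n)) (λ i → admissibleSum (insertPair i w)))
      ≡⟨ ∑-congᴬ (words (2 * n) n) (words-sound (2 * n) n) positions ⟩
    ∑ (words (2 * n) n) (λ w → ∑ (segmentations w) G)
      ≡⟨ ∑-concatMap segmentations (words (2 * n) n) G ⟨
    ∑ (candidates n) G ∎
    where
    admissibleSum : List ℕ → ℕ
    admissibleSum w = ∑ (segmentations w) (λ s → 𝟙 (admissible s) * f s)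
    G : Segmentation → ℕ
    G s = ∑< (2 * n) (λ i → f (insertPairInCycles (suc i) s)) + f (appendPairCycle s)
    positions : ∀ w → IsWord (2 * n) n w → ∑< (suc (2 * n)) (λ i → admissibleSum (insertPair i w)) ≡ ∑ (segmentations w) G
    positions w (|w| , w∈) rewrite sym |w| = ∑-insertPositions w w∈

  decomposition : 1 ≤ n →
    ∑ (candidates (suc n)) (λ s → 𝟙 (isStirling2′ (suc n) s) * g s)
    ≡ ∑ (candidates n) (λ s → 𝟙 (isStirling2′ n s) * (∑< (2 * n) (λ i → g (insertPairInCycles (suc i) s)) + g (appendPairCycle s)))
  decomposition 1≤n = trans ∑-candidates-suc (∑-congᴬ (candidates n) (candidates-sound n) factor)
    where
    factor : ∀ s → IsCandidate n s →
      ∑< (2 * n) (λ i → f (insertPairInCycles (suc i) s)) + f (appendPairCycle s)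
      ≡ 𝟙 (isStirling2′ n s) * (∑< (2 * n) (λ i → g (insertPairInCycles (suc i) s)) + g (appendPairCycle s))
    factor s (s≢[] , |s| , s∈) = begin
      ∑< (2 * n) (λ i → f (insertPairInCycles (suc i) s)) + f (appendPairCycle s)
        ≡⟨ cong₂ _+_ (∑<-cong (2 * n) (λ i i<2n → cong (λ b → 𝟙 b * g (insertPairInCycles (suc i) s))
                        (isStirling2′-insertPairInCycles (suc i) s (s≤s z≤n) (subst (suc i ≤_) (sym |s|) i<2n) s≢[] s∈ s≠[])))
                     (cong (λ b → 𝟙 b * g (appendPairCycle s)) (isStirling2′-appendPairCycle s s≢[] s∈ s≠[])) ⟩
      ∑< (2 * n) (λ i → σ * g (insertPairInCycles (suc i) s)) + σ * g (appendPairCycle s)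
        ≡⟨ cong (_+ σ * g (appendPairCycle s)) (∑<-*ˡ σ (2 * n) (λ i → g (insertPairInCycles (suc i) s))) ⟩
      σ * ∑< (2 * n) (λ i → g (insertPairInCycles (suc i) s)) + σ * g (appendPairCycle s)
        ≡⟨ *-distribˡ-+ σ _ _ ⟨
      σ * (∑< (2 * n) (λ i → g (insertPairInCycles (suc i) s)) + g (appendPairCycle s)) ∎
      where
      σ : ℕ
      σ = 𝟙 (isStirling2′ n s)
      s≠[] : nonempty s ≡ true
      s≠[] = nonempty-of-length s 1≤n |s|

-- Fixed cycles

fixedCycles : Segmentation → ℕ
fixedCycles []       = 0
fixedCycles (b ∷ bs) = 𝟙 (isFixedCycle b) + fixedCycles bs

length-fixed : ∀ b → isFixedCycle b ≡ true → length b ≡ 2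
length-fixed (x ∷ y ∷ []) _ = refl

𝟙≡ᵇ-scale : ∀ k j → k * 𝟙 (k ≡ᵇ j) ≡ j * 𝟙 (k ≡ᵇ j)
𝟙≡ᵇ-scale k j with k ≡ᵇ j in k≡j
... | true  rewrite ≡ᵇ-true⇒≡ {k} {j} k≡j = refl
... | false rewrite *-zeroʳ k | *-zeroʳ j = refl

≡ᵇ-+ʳ : ∀ c a b → (a + c ≡ᵇ b + c) ≡ (a ≡ᵇ b)
≡ᵇ-+ʳ zero    a b rewrite +-identityʳ a | +-identityʳ b = refl
≡ᵇ-+ʳ (suc c) a b rewrite +-suc a c | +-suc b c = ≡ᵇ-+ʳ c a b

module FixedCycles (N : ℕ) where
  open Pair N

  fixedCycles-appendPairCycle : ∀ s → fixedCycles (appendPairCycle s) ≡ fixedCycles s + 1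
  fixedCycles-appendPairCycle []       rewrite ≡ᵇ-refl N = refl
  fixedCycles-appendPairCycle (b ∷ bs) = trans (cong (𝟙 (isFixedCycle b) +_) (fixedCycles-appendPairCycle bs)) (sym (+-assoc _ (fixedCycles bs) 1))

  isFixedCycle-insertPair : ∀ j c b → isFixedCycle (insertPair (suc j) (c ∷ b)) ≡ false
  isFixedCycle-insertPair zero          c b           = refl
  isFixedCycle-insertPair (suc j)       c []          = refl
  isFixedCycle-insertPair (suc zero)    c (y ∷ b)     = refl
  isFixedCycle-insertPair (suc (suc j)) c (y ∷ [])    = refl
  isFixedCycle-insertPair (suc (suc j)) c (y ∷ z ∷ b) = refl

  -- Inserting into a cycle b leaves the other cycles alone and destroys b if it is fixed; c counts the
  -- fixed cycles before b, and the test k = j - [b fixed] is written k + ... = j + [b fixed].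
  ∑-fixedCycles-insertPair : ∀ j c s → Nonempty s →
    ∑< (length (concat s)) (λ i → 𝟙 (c + fixedCycles (insertPairInCycles (suc i) s) ≡ᵇ j))
    ≡ ∑ s (λ b → length b * 𝟙 (c + fixedCycles s ≡ᵇ j + 𝟙 (isFixedCycle b)))
  ∑-fixedCycles-insertPair j c []             []            = refl
  ∑-fixedCycles-insertPair j c ((x ∷ b) ∷ bs) (_ ∷ bs≢[]) = begin
    ∑< (length ((x ∷ b) ++ concat bs)) F
      ≡⟨ cong (λ l → ∑< l F) (length-++ (x ∷ b)) ⟩
    ∑< (length (x ∷ b) + length (concat bs)) F
      ≡⟨ ∑<-+-split (length (x ∷ b)) (length (concat bs)) F ⟩
    ∑< (length (x ∷ b)) F + ∑< (length (concat bs)) (λ i → F (length (x ∷ b) + i))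
      ≡⟨ cong₂ _+_ (trans (∑<-cong (length (x ∷ b)) insideB) (∑<-const (length (x ∷ b)) _))
                   (trans (∑<-cong (length (concat bs)) (λ i _ → afterB i)) (∑-fixedCycles-insertPair j (c + fb) bs bs≢[])) ⟩
    length (x ∷ b) * 𝟙 (c + fixedCycles bs ≡ᵇ j) + ∑ bs (λ b′ → length b′ * 𝟙 (c + fb + fixedCycles bs ≡ᵇ j + 𝟙 (isFixedCycle b′)))
      ≡⟨ cong₂ _+_ (cong (λ z → length (x ∷ b) * 𝟙 z) shiftTest)
                   (∑-cong bs (λ b′ → cong (λ z → length b′ * 𝟙 (z ≡ᵇ j + 𝟙 (isFixedCycle b′))) (+-assoc c fb (fixedCycles bs)))) ⟩
    ∑ ((x ∷ b) ∷ bs) (λ b′ → length b′ * 𝟙 (c + fixedCycles ((x ∷ b) ∷ bs) ≡ᵇ j + 𝟙 (isFixedCycle b′))) ∎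
    where
    fb : ℕ
    fb = 𝟙 (isFixedCycle (x ∷ b))
    F : ℕ → ℕ
    F i = 𝟙 (c + fixedCycles (insertPairInCycles (suc i) ((x ∷ b) ∷ bs)) ≡ᵇ j)
    insideB : ∀ i → i < length (x ∷ b) → F i ≡ 𝟙 (c + fixedCycles bs ≡ᵇ j)
    insideB i i<|b| rewrite <⇒<ᵇ-true i<|b| | isFixedCycle-insertPair i x b = refl
    afterB : ∀ i → F (length (x ∷ b) + i) ≡ 𝟙 (c + fb + fixedCycles (insertPairInCycles (suc i) bs) ≡ᵇ j)
    afterB i rewrite ≥⇒<ᵇ-false {length (x ∷ b) + i} {length (x ∷ b)} (m≤m+n (length (x ∷ b)) i)
                   | trans (cong (_∸ length b) (sym (+-suc (length b) i))) (m+n∸m≡n (length b) (suc i)) =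
      cong (λ z → 𝟙 (z ≡ᵇ j)) (sym (+-assoc c fb _))
    shiftTest : (c + fixedCycles bs ≡ᵇ j) ≡ (c + (fb + fixedCycles bs) ≡ᵇ j + fb)
    shiftTest = sym (trans (cong (_≡ᵇ j + fb) (lemma c fb (fixedCycles bs))) (≡ᵇ-+ʳ fb (c + fixedCycles bs) j))
      where
      lemma : ∀ c f k → c + (f + k) ≡ c + k + f
      lemma = solve-∀

  fixed-balance : ∀ j k s →
    ∑ s (λ b → length b * 𝟙 (k ≡ᵇ j + 𝟙 (isFixedCycle b))) + 2 * fixedCycles s * 𝟙 (k ≡ᵇ j)
    ≡ 2 * fixedCycles s * 𝟙 (k ≡ᵇ suc j) + length (concat s) * 𝟙 (k ≡ᵇ j)
  fixed-balance j k []       = refl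
  fixed-balance j k (b ∷ bs) = trans
    (lemma _ _ (𝟙 (isFixedCycle b)) (fixedCycles bs) (𝟙 (k ≡ᵇ j)) (𝟙 (k ≡ᵇ suc j)) (length b) (length (concat bs)) (oneCycle b) (fixed-balance j k bs))
    (cong (λ z → 2 * fixedCycles (b ∷ bs) * 𝟙 (k ≡ᵇ suc j) + z * 𝟙 (k ≡ᵇ j)) (sym (length-++ b)))
    where
    oneCycle : ∀ b → length b * 𝟙 (k ≡ᵇ j + 𝟙 (isFixedCycle b)) + 2 * 𝟙 (isFixedCycle b) * 𝟙 (k ≡ᵇ j)
                     ≡ 2 * 𝟙 (isFixedCycle b) * 𝟙 (k ≡ᵇ suc j) + length b * 𝟙 (k ≡ᵇ j)
    oneCycle b with isFixedCycle b in fixed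
    ... | false rewrite +-identityʳ j = +-identityʳ _
    ... | true  rewrite length-fixed b fixed | +-comm j 1 = refl
    lemma : ∀ X Y f m I I′ l L → X + 2 * f * I ≡ 2 * f * I′ + l * I → Y + 2 * m * I ≡ 2 * m * I′ + L * I →
            (X + Y) + 2 * (f + m) * I ≡ 2 * (f + m) * I′ + (l + L) * I
    lemma X Y f m I I′ l L p q = trans (regroup X Y f m I) (trans (cong₂ _+_ p q) (collect f m I I′ l L))
      where
      regroup : ∀ X Y f m I → (X + Y) + 2 * (f + m) * I ≡ (X + 2 * f * I) + (Y + 2 * m * I)
      regroup = solve-∀
      collect : ∀ f m I I′ l L → (2 * f * I′ + l * I) + (2 * m * I′ + L * I) ≡ 2 * (f + m) * I′ + (l + L) * I
      collect = solve-∀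

  insertionBalance : ∀ n j s → IsCandidate n s →
    ∑< (2 * n) (λ i → 𝟙 (fixedCycles (insertPairInCycles (suc i) s) ≡ᵇ j)) + 2 * j * 𝟙 (fixedCycles s ≡ᵇ j)
    ≡ 2 * suc j * 𝟙 (fixedCycles s ≡ᵇ suc j) + 2 * n * 𝟙 (fixedCycles s ≡ᵇ j)
  insertionBalance n j s (s≢[] , |s| , _) rewrite sym |s| = begin
    ∑< (length (concat s)) (λ i → 𝟙 (fixedCycles (insertPairInCycles (suc i) s) ≡ᵇ j)) + 2 * j * 𝟙 (k ≡ᵇ j)
      ≡⟨ cong₂ _+_ (∑-fixedCycles-insertPair j 0 s s≢[]) (scale j) ⟩
    ∑ s (λ b → length b * 𝟙 (k ≡ᵇ j + 𝟙 (isFixedCycle b))) + 2 * k * 𝟙 (k ≡ᵇ j)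
      ≡⟨ fixed-balance j k s ⟩
    2 * k * 𝟙 (k ≡ᵇ suc j) + length (concat s) * 𝟙 (k ≡ᵇ j)
      ≡⟨ cong (_+ length (concat s) * 𝟙 (k ≡ᵇ j)) (sym (scale (suc j))) ⟩
    2 * suc j * 𝟙 (k ≡ᵇ suc j) + length (concat s) * 𝟙 (k ≡ᵇ j) ∎
    where
    k : ℕ
    k = fixedCycles s
    scale : ∀ j → 2 * j * 𝟙 (k ≡ᵇ j) ≡ 2 * k * 𝟙 (k ≡ᵇ j)
    scale j = trans (*-assoc 2 j _) (trans (cong (2 *_) (sym (𝟙≡ᵇ-scale k j))) (sym (*-assoc 2 k _)))

Q² : ℕ → ℕ → ℕ
Q² n j = ∑ (candidates n) (λ s → 𝟙 (isStirling2′ n s) * 𝟙 (fixedCycles s ≡ᵇ j))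

shift : (ℕ → ℕ) → ℕ → ℕ
shift F zero    = 0
shift F (suc j) = F j

∑-fixedCycles-suc : ∀ n j → ∑ (candidates n) (λ s → 𝟙 (isStirling2′ n s) * 𝟙 (fixedCycles s + 1 ≡ᵇ j)) ≡ shift (Q² n) j
∑-fixedCycles-suc n zero    = ∑-zero (candidates n) (λ s → trans (cong (λ k → 𝟙 (isStirling2′ n s) * 𝟙 (k ≡ᵇ 0)) (+-comm (fixedCycles s) 1)) (*-zeroʳ (𝟙 (isStirling2′ n s))))
∑-fixedCycles-suc n (suc j) = ∑-cong (candidates n) (λ s → cong (λ k → 𝟙 (isStirling2′ n s) * 𝟙 (k ≡ᵇ suc j)) (+-comm (fixedCycles s) 1))

Q²-recurrence : ∀ n → 1 ≤ n → ∀ j →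
  Q² (suc n) j + 2 * j * Q² n j ≡ 2 * suc j * Q² n (suc j) + 2 * n * Q² n j + shift (Q² n) j
Q²-recurrence n 1≤n j = begin
  Q² (suc n) j + 2 * j * Q² n j
    ≡⟨ cong₂ _+_ (decomposition 1≤n) (sym (∑-*ˡ (2 * j) (candidates n) (λ s → σ s * fixedIs s j))) ⟩
  ∑ (candidates n) (λ s → σ s * (∑< (2 * n) (λ i → fixedIs (insertPairInCycles (suc i) s) j) + fixedIs (appendPairCycle s) j))
    + ∑ (candidates n) (λ s → 2 * j * (σ s * fixedIs s j))
    ≡⟨ ∑-+ (candidates n) _ _ ⟨
  ∑ (candidates n) (λ s → σ s * (∑< (2 * n) (λ i → fixedIs (insertPairInCycles (suc i) s) j) + fixedIs (appendPairCycle s) j) + 2 * j * (σ s * fixedIs s j))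
    ≡⟨ ∑-congᴬ (candidates n) (candidates-sound n) perCandidate ⟩
  ∑ (candidates n) (λ s → 2 * suc j * (σ s * fixedIs s (suc j)) + 2 * n * (σ s * fixedIs s j) + σ s * 𝟙 (fixedCycles s + 1 ≡ᵇ j))
    ≡⟨ ∑-+ (candidates n) _ _ ⟩
  ∑ (candidates n) (λ s → 2 * suc j * (σ s * fixedIs s (suc j)) + 2 * n * (σ s * fixedIs s j)) + ∑ (candidates n) (λ s → σ s * 𝟙 (fixedCycles s + 1 ≡ᵇ j))
    ≡⟨ cong₂ _+_ (trans (∑-+ (candidates n) _ _) (cong₂ _+_ (∑-*ˡ (2 * suc j) (candidates n) _) (∑-*ˡ (2 * n) (candidates n) _)))
                 (∑-fixedCycles-suc n j) ⟩
  2 * suc j * Q² n (suc j) + 2 * n * Q² n j + shift (Q² n) j ∎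
  where
  open Pair (suc n)
  open FixedCycles (suc n)
  open Decomposition n (λ s → 𝟙 (fixedCycles s ≡ᵇ j))
  σ : Segmentation → ℕ
  σ s = 𝟙 (isStirling2′ n s)
  fixedIs : Segmentation → ℕ → ℕ
  fixedIs s j = 𝟙 (fixedCycles s ≡ᵇ j)
  perCandidate : ∀ s → IsCandidate n s →
    σ s * (∑< (2 * n) (λ i → fixedIs (insertPairInCycles (suc i) s) j) + fixedIs (appendPairCycle s) j) + 2 * j * (σ s * fixedIs s j)
    ≡ 2 * suc j * (σ s * fixedIs s (suc j)) + 2 * n * (σ s * fixedIs s j) + σ s * 𝟙 (fixedCycles s + 1 ≡ᵇ j)
  perCandidate s cand rewrite fixedCycles-appendPairCycle s =
    lemma (σ s) (∑< (2 * n) (λ i → fixedIs (insertPairInCycles (suc i) s) j)) (fixedIs s j) (fixedIs s (suc j)) (𝟙 (fixedCycles s + 1 ≡ᵇ j)) j n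
          (insertionBalance n j s cand)
    where
    lemma : ∀ σ A I I₊ B j n → A + 2 * j * I ≡ 2 * suc j * I₊ + 2 * n * I →
            σ * (A + B) + 2 * j * (σ * I) ≡ 2 * suc j * (σ * I₊) + 2 * n * (σ * I) + σ * B
    lemma σ A I I₊ B j n balance = trans (regroup σ A B I j) (trans (cong (λ z → σ * z + σ * B) balance) (spread σ I I₊ B j n))
      where
      regroup : ∀ σ A B I j → σ * (A + B) + 2 * j * (σ * I) ≡ σ * (A + 2 * j * I) + σ * B
      regroup = solve-∀
      spread : ∀ σ I I₊ B j n → σ * (2 * suc j * I₊ + 2 * n * I) + σ * B ≡ 2 * suc j * (σ * I₊) + 2 * n * (σ * I) + σ * B
      spread = solve-∀

-- The closed form

[k+1]*nC[k+1]≡[n∸k]*nCk : ∀ n k → suc k * (n C suc k) ≡ (n ∸ k) * (n C k)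
[k+1]*nC[k+1]≡[n∸k]*nCk zero    k       = trans (*-zeroʳ (suc k)) (cong (_* (0 C k)) (sym (0∸n≡0 k)))
[k+1]*nC[k+1]≡[n∸k]*nCk (suc n) zero    = trans (*-identityˡ _) (trans (nC1≡n (suc n)) (sym (*-identityʳ (suc n))))
[k+1]*nC[k+1]≡[n∸k]*nCk (suc n) (suc k) = begin
  2+k * (suc n C suc (suc k))                      ≡⟨ cong (2+k *_) (nCk+nC[k+1]≡[n+1]C[k+1] n (suc k)) ⟨
  2+k * (n C suc k + (n C suc (suc k)))            ≡⟨ *-distribˡ-+ 2+k (n C suc k) _ ⟩
  2+k * (n C suc k) + 2+k * (n C suc (suc k))        ≡⟨ cong (2+k * (n C suc k) +_) ([k+1]*nC[k+1]≡[n∸k]*nCk n (suc k)) ⟩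
  2+k * (n C suc k) + (n ∸ suc k) * (n C suc k)      ≡⟨ *-distribʳ-+ (n C suc k) 2+k (n ∸ suc k) ⟨
  (2+k + (n ∸ suc k)) * (n C suc k)                ≡⟨ regroup ⟩
  (suc k + (n ∸ k)) * (n C suc k)                  ≡⟨ *-distribʳ-+ (n C suc k) (suc k) (n ∸ k) ⟩
  suc k * (n C suc k) + (n ∸ k) * (n C suc k)        ≡⟨ cong (_+ (n ∸ k) * (n C suc k)) ([k+1]*nC[k+1]≡[n∸k]*nCk n k) ⟩
  (n ∸ k) * (n C k) + (n ∸ k) * (n C suc k)          ≡⟨ *-distribˡ-+ (n ∸ k) (n C k) (n C suc k) ⟨
  (n ∸ k) * (n C k + (n C suc k))                  ≡⟨ cong ((n ∸ k) *_) (nCk+nC[k+1]≡[n+1]C[k+1] n k) ⟩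
  (n ∸ k) * (suc n C suc k)                        ∎
  where
  2+k : ℕ
  2+k = suc (suc k)
  regroup : (2+k + (n ∸ suc k)) * (n C suc k) ≡ (suc k + (n ∸ k)) * (n C suc k)
  regroup with ≤-<-connex n k
  ... | inj₁ n≤k rewrite k>n⇒nCk≡0 {n} {suc k} (s≤s n≤k) = trans (*-zeroʳ (2+k + (n ∸ suc k))) (sym (*-zeroʳ (suc k + (n ∸ k))))
  ... | inj₂ k<n = cong (_* (n C suc k)) (trans (sym (+-suc (suc k) (n ∸ suc k))) (cong (suc k +_) (sym (+-∸-assoc 1 k<n))))

qRec : ℕ → ℕ
qRec zero                = 1
qRec (suc zero)          = 0
qRec (suc (suc m))       = 2 * suc m * (qRec (suc m) + qRec m)

qRec-suc : ∀ m → qRec (suc m) ≡ 2 * m * (qRec m + qRec (m ∸ 1))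
qRec-suc zero    = refl
qRec-suc (suc m) = refl

Recurrence : (ℕ → ℕ → ℕ) → Set
Recurrence F = ∀ n → 1 ≤ n → ∀ j → F (suc n) j + 2 * j * F n j ≡ 2 * suc j * F n (suc j) + 2 * n * F n j + shift (F n) j

-- σ ∈ 𝒬²_n with j fixed cycles: choose the j values k of the cycles (k k); the rest is a Stirling derangement
closedForm : ℕ → ℕ → ℕ
closedForm n j = (n C j) * qRec (n ∸ j)

[1+j+m]∸j≡1+m : ∀ j m → suc j + m ∸ j ≡ suc m
[1+j+m]∸j≡1+m zero    m = refl
[1+j+m]∸j≡1+m (suc j) m = [1+j+m]∸j≡1+m j m

[1+j+m]∸[2+j]≡m∸1 : ∀ j m → suc j + m ∸ suc (suc j) ≡ m ∸ 1
[1+j+m]∸[2+j]≡m∸1 zero    m = refl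
[1+j+m]∸[2+j]≡m∸1 (suc j) m = [1+j+m]∸[2+j]≡m∸1 j m

closedForm-recurrence : Recurrence closedForm
closedForm-recurrence n _ zero rewrite nC1≡n n | qRec-suc n = lemma n (qRec n) (qRec (n ∸ 1))
  where
  lemma : ∀ n a b → 1 * (2 * n * (a + b)) + 0 ≡ 2 * 1 * (n * b) + 2 * n * (1 * a) + 0
  lemma = solve-∀
closedForm-recurrence n _ (suc j) with ≤-<-connex n j
... | inj₁ n≤j rewrite sym (nCk+nC[k+1]≡[n+1]C[k+1] n j) | k>n⇒nCk≡0 (s≤s n≤j) | k>n⇒nCk≡0 (s≤s (m≤n⇒m≤1+n n≤j)) =
  lemma (n C j) (qRec (n ∸ j)) (qRec (n ∸ suc j)) (qRec (n ∸ suc (suc j))) j n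
  where
  lemma : ∀ b x a c j n → (b + 0) * x + 2 * suc j * (0 * a) ≡ 2 * suc (suc j) * (0 * c) + 2 * n * (0 * a) + b * x
  lemma = solve-∀
... | inj₂ j<n with m≤n⇒∃[o]m+o≡n j<n
... | m , refl = begin
  closedForm (suc (suc j + m)) (suc j) + 2 * suc j * closedForm (suc j + m) (suc j)
    ≡⟨ cong₂ (λ a c → a + 2 * suc j * c) (cong₂ _*_ (sym (nCk+nC[k+1]≡[n+1]C[k+1] (suc j + m) j)) (cong qRec ([1+j+m]∸j≡1+m j m))) at₁ ⟩
  (b₀ + b₁) * qRec (suc m) + 2 * suc j * (b₁ * qRec m)
    ≡⟨ cong (λ z → (b₀ + b₁) * z + 2 * suc j * (b₁ * qRec m)) (qRec-suc m) ⟩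
  (b₀ + b₁) * (2 * m * (qRec m + qRec (m ∸ 1))) + 2 * suc j * (b₁ * qRec m)
    ≡⟨ regroup b₀ b₁ m (qRec m) (qRec (m ∸ 1)) j ⟩
  2 * ((m * b₁) * qRec (m ∸ 1)) + 2 * (suc j + m) * (b₁ * qRec m) + b₀ * (2 * m * (qRec m + qRec (m ∸ 1)))
    ≡⟨ cong₂ (λ z w → 2 * (z * qRec (m ∸ 1)) + 2 * (suc j + m) * (b₁ * qRec m) + b₀ * w) absorb (sym (qRec-suc m)) ⟩
  2 * ((suc (suc j) * b₂) * qRec (m ∸ 1)) + 2 * (suc j + m) * (b₁ * qRec m) + b₀ * qRec (suc m)
    ≡⟨ cong (λ z → z + 2 * (suc j + m) * (b₁ * qRec m) + b₀ * qRec (suc m)) (reassoc j b₂ (qRec (m ∸ 1))) ⟩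
  2 * suc (suc j) * (b₂ * qRec (m ∸ 1)) + 2 * (suc j + m) * (b₁ * qRec m) + b₀ * qRec (suc m)
    ≡⟨ cong₂ _+_ (cong₂ (λ a c → 2 * suc (suc j) * a + 2 * (suc j + m) * c) at₂ at₁) (cong (b₀ *_) (cong qRec ([1+j+m]∸j≡1+m j m))) ⟨
  2 * suc (suc j) * closedForm (suc j + m) (suc (suc j)) + 2 * (suc j + m) * closedForm (suc j + m) (suc j) + closedForm (suc j + m) j ∎
  where
  b₀ b₁ b₂ : ℕ
  b₀ = ((suc j + m) C j)
  b₁ = ((suc j + m) C suc j)
  b₂ = ((suc j + m) C suc (suc j))
  at₁ : closedForm (suc j + m) (suc j) ≡ b₁ * qRec m
  at₁ = cong (b₁ *_) (cong qRec (m+n∸m≡n (suc j) m))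
  at₂ : closedForm (suc j + m) (suc (suc j)) ≡ b₂ * qRec (m ∸ 1)
  at₂ = cong (b₂ *_) (cong qRec ([1+j+m]∸[2+j]≡m∸1 j m))
  absorb : m * b₁ ≡ suc (suc j) * b₂
  absorb = sym (trans ([k+1]*nC[k+1]≡[n∸k]*nCk (suc j + m) (suc j)) (cong (_* b₁) (m+n∸m≡n (suc j) m)))
  regroup : ∀ b₀ b₁ m a c j → (b₀ + b₁) * (2 * m * (a + c)) + 2 * suc j * (b₁ * a)
            ≡ 2 * ((m * b₁) * c) + 2 * (suc j + m) * (b₁ * a) + b₀ * (2 * m * (a + c))
  regroup = solve-∀
  reassoc : ∀ j b c → 2 * ((suc (suc j) * b) * c) ≡ 2 * suc (suc j) * (b * c)
  reassoc = solve-∀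

shift-cong : ∀ {f g : ℕ → ℕ} → (∀ j → f j ≡ g j) → ∀ j → shift f j ≡ shift g j
shift-cong e zero    = refl
shift-cong e (suc j) = e j

recurrence-step : ∀ F G → Recurrence F → Recurrence G → ∀ n → 1 ≤ n → (∀ j → F n j ≡ G n j) → ∀ j → F (suc n) j ≡ G (suc n) j
recurrence-step F G recF recG n 1≤n IH j = +-cancelʳ-≡ (2 * j * G n j) (F (suc n) j) (G (suc n) j) (begin
  F (suc n) j + 2 * j * G n j                              ≡⟨ cong (λ z → F (suc n) j + 2 * j * z) (sym (IH j)) ⟩
  F (suc n) j + 2 * j * F n j                              ≡⟨ recF n 1≤n j ⟩
  2 * suc j * F n (suc j) + 2 * n * F n j + shift (F n) j  ≡⟨ cong₂ _+_ (cong₂ (λ a b → 2 * suc j * a + 2 * n * b) (IH (suc j)) (IH j)) (shift-cong IH j) ⟩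
  2 * suc j * G n (suc j) + 2 * n * G n j + shift (G n) j  ≡⟨ recG n 1≤n j ⟨
  G (suc n) j + 2 * j * G n j                              ∎)

recurrence-unique : ∀ F G → Recurrence F → Recurrence G → (∀ j → F 1 j ≡ G 1 j) → ∀ m j → F (suc m) j ≡ G (suc m) j
recurrence-unique F G recF recG base zero    = base
recurrence-unique F G recF recG base (suc m) = recurrence-step F G recF recG (suc m) (s≤s z≤n) (recurrence-unique F G recF recG base m)

not-any-isFixedCycle : ∀ s → not (any isFixedCycle s) ≡ (fixedCycles s ≡ᵇ 0)
not-any-isFixedCycle []       = refl
not-any-isFixedCycle (b ∷ bs) with isFixedCycle b
... | true  = refl
... | false = not-any-isFixedCycle bs

q≡Q² : ∀ n → q (suc n) ≡ Q² (suc n) 0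
q≡Q² n = trans (length-filterᵇ (isStirlingDerangement (suc n)) (candidates (suc n)))
               (∑-cong (candidates (suc n)) (λ s → trans (𝟙-∧ (isStirling2 (suc n) s) _)
                  (cong₂ (λ a b → 𝟙 a * 𝟙 b) (isStirling2≡isStirling2′ (suc n) s) (not-any-isFixedCycle s))))

Q²≡closedForm : ∀ m j → Q² (suc m) j ≡ closedForm (suc m) j
Q²≡closedForm = recurrence-unique Q² closedForm Q²-recurrence closedForm-recurrence order1
  where
  order1 : ∀ j → Q² 1 j ≡ closedForm 1 j
  order1 zero          = refl
  order1 (suc zero)    = refl
  order1 (suc (suc j)) = refl

q≡qRec : ∀ n → q n ≡ qRec n
q≡qRec zero    = refl
q≡qRec (suc n) = trans (q≡Q² n) (trans (Q²≡closedForm n 0) (*-identityˡ (qRec (suc n))))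

corollary18 : ((n : ℕ) → 1 ≤ n → q (suc n) ≡ 2 * n * (q n + q (n ∸ 1)))
              × (q 0 ≡ 1) × (q 1 ≡ 0) × (q 2 ≡ 2)
corollary18 = recurrence , refl , q≡qRec 1 , q≡qRec 2
  where
  recurrence : (n : ℕ) → 1 ≤ n → q (suc n) ≡ 2 * n * (q n + q (n ∸ 1))
  recurrence n _ = begin
    q (suc n)                              ≡⟨ q≡qRec (suc n) ⟩
    qRec (suc n)                           ≡⟨ qRec-suc n ⟩
    2 * n * (qRec n + qRec (n ∸ 1))        ≡⟨ cong₂ (λ a b → 2 * n * (a + b)) (q≡qRec n) (q≡qRec (n ∸ 1)) ⟨
    2 * n * (q n + q (n ∸ 1))              ∎
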